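{- Let $\Gamma$ be a doubly regular $(m,r)$-team semicomplete multipartite digraph with partite sets $V_1,\dots,V_m$ and parameters $t,\alpha_s,\beta_s,\gamma_s,\eta_s$ as in the context. Then $\Gamma$ is of one of the following three types: Type I: $\beta_1+\beta_2-\alpha_1-\alpha_2=r$ and $\Gamma$ is an $r$-coclique extension of a semicomplete digraph; Type II: $\beta_1+\beta_2-\alpha_1-\alpha_2=0$ and for each pair $(i,j)$ with $i\neq j$ the number $|A_j^+(x)|$ is the same value $c_{ij}$ for all $x\in V_i$, and $c_{ij}=c_{ji}=\frac{r-e_{ij}}{2}$, where $e_{ij}=|E_j(x)|$ for $x\in V_i$; Type III: $\beta_1+\beta_2-\alpha_1-\alpha_2=\frac{r}{2}$ and for each pair $(i,j)$ with $i\neq j$ one of the following holds: (a) $V_i\times V_j\subseteq E\Gamma$; (b) $V_i$ is partitioned into two nonempty sets $V_i=V_i'\cup V_i''$ with $(V_i'\times V_j)\cup(V_j\times V_i'')\subseteq A\vec\Gamma$, or the same holds with $i$ and $j$ interchanged; (c) $V_i=V_i'\cup V_i''$ and $V_j=V_j'\cup V_j''$ are partitions into nonempty sets with $(V_i'\times V_j')\cup(V_i''\times V_j'')\subseteq E\Gamma$ and $(V_i'\times V_j'')\cup(V_j'\times V_i'')\subseteq A\vec\Gamma$.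
   Context: A digraph has a finite vertex set $V\Gamma$ and arc set $A\Gamma$ of ordered pairs of distinct vertices; its underlying graph joins $x,y$ iff $(x,y)$ or $(y,x)$ is an arc. $K^m_r$ is the complete multipartite graph with $m$ parts each of size $r$; an $(m,r)$-team semicomplete multipartite digraph ($m,r\geq 2$) is a digraph whose underlying graph is $K^m_r$; its parts are the partite sets. A digraph is semicomplete if its underlying graph is complete. For digraphs $\Gamma,\Sigma$, the lexicographic product $\Gamma\circ\Sigma$ has vertex set $V\Gamma\times V\Sigma$ with $((u_1,u_2),(v_1,v_2))$ an arc iff $(u_1,v_1)\in A\Gamma$ or ($u_1=v_1$ and $(u_2,v_2)\in A\Sigma$); an $r$-coclique extension of $\Gamma$ is $\Gamma\circ\overline K_r$ with $\overline K_r$ the arcless digraph on $r$ vertices. Let $E\Gamma=\{(x,y):(x,y),(y,x)\in A\Gamma\}$, $\overline\Gamma=(V\Gamma,E\Gamma)$, $\vec\Gamma=(V\Gamma,A\Gamma\setminus E\Gamma)$, with adjacency matrices $A_0$, $A_1$ respectively. An $(m,r)$-team semicomplete multipartite digraph $\Gamma$ that is regular (all in- and out-degrees equal) is doubly regular if there exist integers $t,\alpha_s,\beta_s,\gamma_s,\eta_s$ ($s=0,1,2$) such that $A_iA_j=t\delta_{0,i+j}I+\alpha_{i+j}A_1+\beta_{i+j}A_1^{\top}+\gamma_{i+j}A_0+\eta_{i+j}(J-I-A_1-A_1^{\top}-A_0)$ for all $i,j\in\{0,1\}$ ($\delta$ Kronecker delta, $J$ all-ones matrix). For $x\in V_i$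 and $j\neq i$: $A_j^+(x)=\{y\in V_j:(x,y)\in A\vec\Gamma\}$ and $E_j(x)=\{y\in V_j:(x,y)\in E\Gamma\}$. -}

module Defs where

open import Data.Nat using (ℕ; zero; suc; _+_; _*_; _≥_)
open import Data.Integer as ℤ using (ℤ; +_)
open import Data.Fin using (Fin; zero; suc; _≟_)
open import Data.Bool using (Bool; true; false; _∧_; _∨_; not)
open import Data.Product using (_×_; _,_; Σ; ∃; ∃-syntax; proj₁; proj₂)
open import Data.Product.Properties using (≡-dec)
open import Data.Sum using (_⊎_)
open import Relation.Binary.PropositionalEquality using (_≡_; _≢_)
open import Relation.Binary.Definitions using (DecidableEquality)
open import Relation.Nullary.Decidable using (⌊_⌋)
open import Function.Bundles using (_↔_; Inverse)

record Digraph (V : Set) : Set where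
  constructor mkDigraph
  field
    arc : V → V → Bool
open Digraph public

Loopless : {V : Set} → Digraph V → Set
Loopless {V} Γ = ∀ (x : V) → arc Γ x x ≡ false

Semicomplete : {V : Set} → Digraph V → Set
Semicomplete {V} Γ =
  Loopless Γ × (∀ (x y : V) → x ≢ y → (arc Γ x y ∨ arc Γ y x) ≡ true)

lexProd : {V W : Set} → DecidableEquality V → Digraph V → Digraph W → Digraph (V × W)
arc (lexProd _≟V_ Γ Σ') (u₁ , u₂) (v₁ , v₂) =
  arc Γ u₁ v₁ ∨ (⌊ u₁ ≟V v₁ ⌋ ∧ arc Σ' u₂ v₂)

coclique : (r : ℕ) → Digraph (Fin r)
arc (coclique r) _ _ = false

_≅_ : {V W : Set} → Digraph V → Digraph W → Set
_≅_ {V} {W} Γ Δ =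
  Σ (V ↔ W) λ f → ∀ (x y : V) →
    arc Γ x y ≡ arc Δ (Inverse.to f x) (Inverse.to f y)

CocliqueExtOfSemicomplete : {V : Set} → (r : ℕ) → Digraph V → Set
CocliqueExtOfSemicomplete r Γ =
  ∃[ n ] Σ (Digraph (Fin n)) λ Σ' →
    Semicomplete Σ' × (Γ ≅ lexProd _≟_ Σ' (coclique r))

-- (m,r)-team semicomplete multipartite digraphs.  Vertex set
-- Fin m × Fin r, the i-th partite set being V_i = {(i,a) : a : Fin r}.

Vtx : ℕ → ℕ → Set
Vtx m r = Fin m × Fin r

_≟v_ : {m r : ℕ} → DecidableEquality (Vtx m r)
_≟v_ = ≡-dec _≟_ _≟_

IsTeamSMD : (m r : ℕ) → Digraph (Vtx m r) → Set
IsTeamSMD m r Γ =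
  m ≥ 2 × r ≥ 2 ×
  (∀ (i : Fin m) (a b : Fin r) → arc Γ (i , a) (i , b) ≡ false) ×
  (∀ (i j : Fin m) (a b : Fin r) → i ≢ j →
     (arc Γ (i , a) (j , b) ∨ arc Γ (j , b) (i , a)) ≡ true)

∑ : (n : ℕ) → (Fin n → ℕ) → ℕ
∑ zero    f = 0
∑ (suc n) f = f zero + ∑ n (λ k → f (suc k))

∑V : {m r : ℕ} → (Vtx m r → ℕ) → ℕ
∑V {m} {r} f = ∑ m (λ i → ∑ r (λ a → f (i , a)))

b2n : Bool → ℕ
b2n true  = 1
b2n false = 0

module _ {m r : ℕ} (Γ : Digraph (Vtx m r)) where

  outdeg : Vtx m r → ℕ
  outdeg x = ∑V (λ y → b2n (arc Γ x y))

  indeg : Vtx m r → ℕ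
  indeg x = ∑V (λ y → b2n (arc Γ y x))

  Regular : Set
  Regular = ∃[ k ] (∀ x → outdeg x ≡ k × indeg x ≡ k)

  symArc : Vtx m r → Vtx m r → Bool
  symArc x y = arc Γ x y ∧ arc Γ y x

  oneArc : Vtx m r → Vtx m r → Bool
  oneArc x y = arc Γ x y ∧ not (arc Γ y x)

  Amat : Fin 2 → Vtx m r → Vtx m r → ℕ
  Amat zero       x y = b2n (symArc x y)
  Amat (suc zero) x y = b2n (oneArc x y)

  prodEntry : Fin 2 → Fin 2 → Vtx m r → Vtx m r → ℕ
  prodEntry i j x y = ∑V (λ z → Amat i x z * Amat j z y)

  Imat : Vtx m r → Vtx m r → ℕ
  Imat x y = b2n ⌊ x ≟v y ⌋

  idx : Fin 2 → Fin 2 → Fin 3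
  idx zero       zero       = zero
  idx zero       (suc zero) = suc zero
  idx (suc zero) zero       = suc zero
  idx (suc zero) (suc zero) = suc (suc zero)

  δ₀ : Fin 3 → ℤ
  δ₀ zero = + 1
  δ₀ (suc _) = + 0

  record DRParams : Set where
    field
      t : ℤ
      α β γ η : Fin 3 → ℤ

  -- A_i A_j = t δ_{0,i+j} I + α_{i+j} A₁ + β_{i+j} A₁ᵀ + γ_{i+j} A₀
  --           + η_{i+j} (J − I − A₁ − A₁ᵀ − A₀)
  DREntry : DRParams → Fin 2 → Fin 2 → Vtx m r → Vtx m r → Set
  DREntry p i j x y =
      + prodEntry i j x y ≡
        ((((DRParams.t p ℤ.* δ₀ s ℤ.* + Imat x y
        ℤ.+ DRParams.α p s ℤ.* + A₁ x y)
        ℤ.+ DRParams.β p s ℤ.* + A₁ y x)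
        ℤ.+ DRParams.γ p s ℤ.* + A₀ x y)
        ℤ.+ DRParams.η p s ℤ.*
              (+ 1 ℤ.- + Imat x y ℤ.- + A₁ x y ℤ.- + A₁ y x ℤ.- + A₀ x y))
    where
      s = idx i j
      A₀ = Amat zero
      A₁ = Amat (suc zero)

  SatisfiesDR : DRParams → Set
  SatisfiesDR p = ∀ (i j : Fin 2) (x y : Vtx m r) → DREntry p i j x y

  DoublyRegular : Set
  DoublyRegular = Regular × ∃[ p ] SatisfiesDR p

  keyValue : DRParams → ℤ
  keyValue p = DRParams.β p (suc zero) ℤ.+ DRParams.β p (suc (suc zero))
               ℤ.- DRParams.α p (suc zero) ℤ.- DRParams.α p (suc (suc zero))

  outTo : Vtx m r → Fin m → ℕ
  outTo x j = ∑ r (λ b → b2n (oneArc x (j , b)))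

  symTo : Vtx m r → Fin m → ℕ
  symTo x j = ∑ r (λ b → b2n (symArc x (j , b)))

  TypeI : DRParams → Set
  TypeI p = keyValue p ≡ + r × CocliqueExtOfSemicomplete r Γ

  -- c_ij = c_ji = (r − e_ij)/2, written as 2·c_ij + e_ij = r
  TypeII : DRParams → Set
  TypeII p = keyValue p ≡ + 0 ×
    (Σ (Fin m → Fin m → ℕ) λ c → Σ (Fin m → Fin m → ℕ) λ e →
      ∀ (i j : Fin m) → i ≢ j →
        (∀ (a : Fin r) → outTo (i , a) j ≡ c i j) ×
        (∀ (a : Fin r) → symTo (i , a) j ≡ e i j) ×
        c i j ≡ c j i ×
        2 * c i j + e i j ≡ r)

  -- a partition V_i = V_i' ∪ V_i'' into nonempty sets, V_i' = {(i,a) : P a ≡ true}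
  NontrivialSplit : (Fin r → Bool) → Set
  NontrivialSplit P = (∃[ a ] P a ≡ true) × (∃[ a ] P a ≡ false)

  CaseA : Fin m → Fin m → Set
  CaseA i j = ∀ (a b : Fin r) → symArc (i , a) (j , b) ≡ true

  CaseB : Fin m → Fin m → Set
  CaseB i j = Σ (Fin r → Bool) λ P → NontrivialSplit P ×
    (∀ (a b : Fin r) →
       (P a ≡ true  → oneArc (i , a) (j , b) ≡ true) ×
       (P a ≡ false → oneArc (j , b) (i , a) ≡ true))

  CaseC : Fin m → Fin m → Set
  CaseC i j = Σ (Fin r → Bool) λ P → Σ (Fin r → Bool) λ Q →
    NontrivialSplit P × NontrivialSplit Q ×
    (∀ (a b : Fin r) →
       (P a ≡ true  → Q b ≡ true  → symArc (i , a) (j , b) ≡ true) ×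
       (P a ≡ false → Q b ≡ false → symArc (i , a) (j , b) ≡ true) ×
       (P a ≡ true  → Q b ≡ false → oneArc (i , a) (j , b) ≡ true) ×
       (Q b ≡ true  → P a ≡ false → oneArc (j , b) (i , a) ≡ true))

  -- β₁+β₂−α₁−α₂ = r/2, written as 2·(β₁+β₂−α₁−α₂) = r
  TypeIII : DRParams → Set
  TypeIII p = + 2 ℤ.* keyValue p ≡ + r ×
    (∀ (i j : Fin m) → i ≢ j →
      CaseA i j ⊎ (CaseB i j ⊎ CaseB j i) ⊎ CaseC i j)

{-# OPTIONS --safe #-}
module Submission where

-- Let S = A₁ − A₁ᵀ, and let K = A₀ + A₁ + A₁ᵀ be the adjacency matrix of K^m_r.
-- Regularity makes every row and column sum of S vanish, so for x ∈ V_i and y ∈ V_j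
-- the (x, y) entry of SK + KS is minus the sum of the row of x and the column of y
-- in the (i, j) block D of S.  The doubly regular equations evaluate the same entry
-- as −2κ S(x, y) with κ = β₁ + β₂ − α₁ − α₂.  So every block D, an r × r matrix with
-- entries in {−1, 0, 1}, satisfies  row a + column b = 2κ D(a, b).
--
-- If κ = 0 every row of D sums to 0: each x sends as many one-way arcs to V_j as it
-- receives from it, and Type II follows.  Otherwise D is additive,
-- D(a, b) + D(a′, b′) = D(a, b′) + D(a′, b), and if also 2κ ≠ r then D is constant,
-- hence zero unless κ = r.  Thus κ = r gives Type I, while for 2κ ∉ {0, r, 2r} there
-- are no one-way arcs at all, so that α and β may be replaced by 0: Type II again.
-- If 2κ = r, all rows and columns of D contain equally many zeros (|E_j(x)| = |E_i(y)|
-- because A₀A₀ has constant diagonal t and A₀A₁ = A₁A₀), and an additive {−1, 0, 1}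
-- matrix with this property is zero, has constant rows or constant columns of signs
-- ±1, or is [P a] − [Q b] for indicators P, Q: the cases (a), (b), (c) of Type III.

open import Defs
open import Data.Nat using (ℕ)
open import Data.Product using (_×_; Σ)
open import Data.Sum using (_⊎_)

open import Data.Bool using (Bool; true; false; _∧_; _∨_; not)
open import Data.Bool.Properties using (∧-comm; ∨-identityʳ)
open import Data.Fin using (Fin; zero; suc; _≟_)
open import Data.Fin.Properties using (any?)
open import Data.Integer as ℤ using (ℤ; +_; -[1+_]; _+_; _-_; _*_; -_; 0ℤ; 1ℤ; -1ℤ)
import Data.Integer.Properties as ℤ
open import Data.Integer.Tactic.RingSolver using (solve-∀)
open import Data.Nat as ℕ using (zero; suc; _≤_; z≤n; s≤s)
import Data.Nat.Properties as ℕ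
import Data.Nat.Tactic.RingSolver as ℕ-Solver
open import Data.Product using (_,_; proj₁; proj₂; ∃; ∃-syntax)
open import Data.Sum using (inj₁; inj₂)
open import Function.Base using (_∘_)
open import Function.Construct.Identity using (↔-id)
open import Relation.Binary.PropositionalEquality
open import Relation.Nullary using (¬_; Dec; yes; no; ¬?; contradiction)
open import Relation.Nullary.Decidable
  using (⌊_⌋; does; dec-true; dec-false; decidable-stable; isYes≗does)
open import Algebra.Properties.AbelianGroup ℤ.+-0-abelianGroup
  using (∙-cancelʳ; identityʳ-unique; inverseʳ-unique)
open import Algebra.Properties.Semiring.Sum ℤ.+-*-semiring
  using (sum-syntax; sum-cong-≗; ∑-distrib-+; ∑-comm; *-distribˡ-sum; *-distribʳ-sum)

*-cancel-zero : ∀ {k x} → k ≢ 0ℤ → k * x ≡ 0ℤ → x ≡ 0ℤ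
*-cancel-zero {k} k≢0 kx≡0 with ℤ.i*j≡0⇒i≡0∨j≡0 k kx≡0
... | inj₁ k≡0 = contradiction k≡0 k≢0
... | inj₂ x≡0 = x≡0

x≡-x⇒x≡0 : ∀ {x} → x ≡ - x → x ≡ 0ℤ
x≡-x⇒x≡0 {+ zero}    _  = refl
x≡-x⇒x≡0 {+ suc _}   ()
x≡-x⇒x≡0 { -[1+ _ ]} ()

-x≡y⇒x≡-y : ∀ {x y} → - x ≡ y → x ≡ - y
-x≡y⇒x≡-y {x} -x≡y = trans (sym (ℤ.neg-involutive x)) (cong -_ -x≡y)

-+-cancel : ∀ x y c → x - y ≡ (x + c) - (y + c)
-+-cancel = solve-∀

+≡+⇒-≡- : ∀ {x y z w} → x + y ≡ z + w → x - w ≡ z - y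
+≡+⇒-≡- {x} {y} {z} {w} eq = begin
  x - w            ≡⟨ shift x y w ⟩
  x + y - (y + w)  ≡⟨ cong (_- (y + w)) eq ⟩
  z + w - (y + w)  ≡⟨ -+-cancel z y w ⟨
  z - y            ∎
  where
  open ≡-Reasoning
  shift : ∀ x y w → x - w ≡ x + y - (y + w)
  shift = solve-∀

*-distribʳ-− : ∀ x y z → (x - y) * z ≡ x * z - y * z
*-distribʳ-− = solve-∀

*-distribˡ-− : ∀ x y z → x * (y - z) ≡ x * y - x * z
*-distribˡ-− = solve-∀

inhabited⇒≢0 : ∀ {r} → Fin r → + r ≢ 0ℤ
inhabited⇒≢0 {suc _} _ ()

2r≢r : ∀ n → + 2 * + suc n ≢ + suc n
2r≢r n 2r≡r = ℕ.m+1+n≢m n (ℕ.suc-injective (ℤ.+-injective 2r≡r))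

∑-cong : ∀ n {f g : Fin n → ℕ} → (∀ k → f k ≡ g k) → ∑ n f ≡ ∑ n g
∑-cong zero    f≗g = refl
∑-cong (suc n) f≗g = cong₂ ℕ._+_ (f≗g zero) (∑-cong n (f≗g ∘ suc))

pos-∑ : ∀ n (f : Fin n → ℕ) → + ∑ n f ≡ ∑[ i < n ] (+ f i)
pos-∑ zero    f = refl
pos-∑ (suc n) f = trans (ℤ.pos-+ (f zero) _) (cong (_+_ (+ f zero)) (pos-∑ n (f ∘ suc)))

∑-const : ∀ n x → ∑[ i < n ] x ≡ + n * x
∑-const zero    x = refl
∑-const (suc n) x = trans (cong (_+_ x) (∑-const n x)) (sym (ℤ.suc-* (+ n) x))

∑-const-≢0 : ∀ {n c} {f : Fin (suc n) → ℤ} → c ≢ 0ℤ → (∀ a → f a ≡ c) → ∑[ a < suc n ] f a ≢ 0ℤ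
∑-const-≢0 {n} {c} {f} c≢0 f≡c ∑≡0 = c≢0 (*-cancel-zero {+ suc n} (λ ()) (begin
  + suc n * c           ≡⟨ ∑-const (suc n) c ⟨
  ∑[ a < suc n ] c      ≡⟨ sum-cong-≗ (sym ∘ f≡c) ⟩
  ∑[ a < suc n ] f a    ≡⟨ ∑≡0 ⟩
  0ℤ                    ∎))
  where open ≡-Reasoning

∑-distrib-− : ∀ n (f g : Fin n → ℤ) → ∑[ i < n ] (f i - g i) ≡ ∑[ i < n ] f i - ∑[ i < n ] g i
∑-distrib-− zero    f g = refl
∑-distrib-− (suc n) f g =
  trans (cong (_+_ (f zero - g zero)) (∑-distrib-− n (f ∘ suc) (g ∘ suc)))
        (interchange (f zero) (g zero) _ _)
  where
  interchange : ∀ a b c d → (a - b) + (c - d) ≡ (a + c) - (b + d)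
  interchange = solve-∀

∑-neg : ∀ n (f : Fin n → ℤ) → ∑[ i < n ] (- f i) ≡ - ∑[ i < n ] f i
∑-neg n f = begin
  ∑[ i < n ] (- f i)       ≡⟨ sum-cong-≗ (sym ∘ ℤ.-1*i≡-i ∘ f) ⟩
  ∑[ i < n ] (-1ℤ * f i)   ≡⟨ *-distribˡ-sum -1ℤ f ⟨
  -1ℤ * ∑[ i < n ] f i     ≡⟨ ℤ.-1*i≡-i _ ⟩
  - ∑[ i < n ] f i         ∎
  where open ≡-Reasoning

does-suc≟suc : ∀ {n} (i j : Fin n) → does (suc i ≟ suc j) ≡ does (i ≟ j)
does-suc≟suc i j with i ≟ j
... | yes _ = refl
... | no  _ = refl

∑-δ : ∀ n (f : Fin n → ℤ) j → ∑[ i < n ] (f i * + b2n (does (i ≟ j))) ≡ f j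
∑-δ (suc n) f zero = begin
  f zero * 1ℤ + ∑[ i < n ] (f (suc i) * 0ℤ)
    ≡⟨ cong₂ _+_ (ℤ.*-identityʳ (f zero)) (sum-cong-≗ (ℤ.*-zeroʳ ∘ f ∘ suc)) ⟩
  f zero + ∑[ i < n ] 0ℤ
    ≡⟨ cong (_+_ (f zero)) (trans (∑-const n 0ℤ) (ℤ.*-zeroʳ (+ n))) ⟩
  f zero + 0ℤ
    ≡⟨ ℤ.+-identityʳ (f zero) ⟩
  f zero ∎
  where open ≡-Reasoning
∑-δ (suc n) f (suc j) = begin
  f zero * 0ℤ + ∑[ i < n ] (f (suc i) * + b2n (does (suc i ≟ suc j)))
    ≡⟨ cong₂ _+_ (ℤ.*-zeroʳ (f zero))
                 (sum-cong-≗ (λ i → cong (λ b → f (suc i) * + b2n b) (does-suc≟suc i j))) ⟩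
  0ℤ + ∑[ i < n ] (f (suc i) * + b2n (does (i ≟ j)))
    ≡⟨ ℤ.+-identityˡ _ ⟩
  ∑[ i < n ] (f (suc i) * + b2n (does (i ≟ j)))
    ≡⟨ ∑-δ n (f ∘ suc) j ⟩
  f (suc j) ∎
  where open ≡-Reasoning

count : ∀ {n} {A : Fin n → Set} → (∀ k → Dec (A k)) → ℕ
count {n} A? = ∑ n (λ k → b2n (does (A? k)))


count≤n : ∀ {n} {A : Fin n → Set} (A? : ∀ k → Dec (A k)) → count A? ≤ n
count≤n {zero}  A? = z≤n
count≤n {suc n} A? with A? zero
... | yes _ = s≤s (count≤n (A? ∘ suc))
... | no  _ = ℕ.m≤n⇒m≤1+n (count≤n (A? ∘ suc))

count≡0⇒none : ∀ {n} {A : Fin n → Set} (A? : ∀ k → Dec (A k)) → count A? ≡ 0 → ∀ k → ¬ A k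
count≡0⇒none {suc n} A? c≡0 k       with A? zero
count≡0⇒none {suc n} A? ()  k       | yes _
count≡0⇒none {suc n} A? c≡0 zero    | no ¬A₀ = ¬A₀
count≡0⇒none {suc n} A? c≡0 (suc k) | no _   = count≡0⇒none (A? ∘ suc) c≡0 k

count≡n⇒all : ∀ {n} {A : Fin n → Set} (A? : ∀ k → Dec (A k)) → count A? ≡ n → ∀ k → A k
count≡n⇒all {suc n} A? c≡n k       with A? zero
count≡n⇒all {suc n} A? c≡n zero    | yes A₀ = A₀
count≡n⇒all {suc n} A? c≡n (suc k) | yes _  = count≡n⇒all (A? ∘ suc) (ℕ.suc-injective c≡n) k
count≡n⇒all {suc n} A? c≡n k       | no _   =
  contradiction (count≤n (A? ∘ suc)) (ℕ.<⇒≱ (ℕ.≤-reflexive (sym c≡n)))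

count≢0⇒some : ∀ {n} {A : Fin n → Set} (A? : ∀ k → Dec (A k)) → count A? ≢ 0 → ∃ A
count≢0⇒some {zero}  A? c≢0 = contradiction refl c≢0
count≢0⇒some {suc n} A? c≢0 with A? zero
... | yes A₀ = zero , A₀
... | no  _  with count≢0⇒some (A? ∘ suc) c≢0
...   | k , Aₖ = suc k , Aₖ

count≢n⇒some-not : ∀ {n} {A : Fin n → Set} (A? : ∀ k → Dec (A k)) → count A? ≢ n → ∃ (¬_ ∘ A)
count≢n⇒some-not {zero}  A? c≢n = contradiction refl c≢n
count≢n⇒some-not {suc n} A? c≢n with A? zero
... | no  ¬A₀ = zero , ¬A₀
... | yes _   with count≢n⇒some-not (A? ∘ suc) (c≢n ∘ cong suc)
...   | k , ¬Aₖ = suc k , ¬Aₖ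

∑ᵥ : ∀ {m r} → (Vtx m r → ℤ) → ℤ
∑ᵥ {m} {r} f = ∑[ i < m ] ∑[ a < r ] f (i , a)

module _ {m r : ℕ} where

  pos-∑ᵥ : (f : Vtx m r → ℕ) → + ∑V f ≡ ∑ᵥ (λ z → + f z)
  pos-∑ᵥ f = trans (pos-∑ m _) (sum-cong-≗ (λ i → pos-∑ r (λ a → f (i , a))))

  ∑ᵥ-cong : {f g : Vtx m r → ℤ} → (∀ z → f z ≡ g z) → ∑ᵥ f ≡ ∑ᵥ g
  ∑ᵥ-cong f≗g = sum-cong-≗ (λ i → sum-cong-≗ (λ a → f≗g (i , a)))

  ∑ᵥ-distrib-+ : (f g : Vtx m r → ℤ) → ∑ᵥ (λ z → f z + g z) ≡ ∑ᵥ f + ∑ᵥ g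
  ∑ᵥ-distrib-+ f g =
    trans (sum-cong-≗ (λ i → ∑-distrib-+ (λ a → f (i , a)) (λ a → g (i , a))))
          (∑-distrib-+ (λ i → ∑[ a < r ] f (i , a)) (λ i → ∑[ a < r ] g (i , a)))

  ∑ᵥ-distrib-− : (f g : Vtx m r → ℤ) → ∑ᵥ (λ z → f z - g z) ≡ ∑ᵥ f - ∑ᵥ g
  ∑ᵥ-distrib-− f g =
    trans (sum-cong-≗ (λ i → ∑-distrib-− r (λ a → f (i , a)) (λ a → g (i , a))))
          (∑-distrib-− m (λ i → ∑[ a < r ] f (i , a)) (λ i → ∑[ a < r ] g (i , a)))

  ∑ᵥ-*ˡ : ∀ c (f : Vtx m r → ℤ) → c * ∑ᵥ f ≡ ∑ᵥ (λ z → c * f z)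
  ∑ᵥ-*ˡ c f = trans (*-distribˡ-sum c (λ i → ∑[ a < r ] f (i , a)))
                    (sum-cong-≗ (λ i → *-distribˡ-sum c (λ a → f (i , a))))

  ∑ᵥ-part : ∀ (f : Vtx m r → ℤ) j → ∑ᵥ (λ z → f z * + b2n (does (proj₁ z ≟ j))) ≡ ∑[ b < r ] f (j , b)
  ∑ᵥ-part f j =
    trans (sum-cong-≗ (λ i → sym (*-distribʳ-sum (+ b2n (does (i ≟ j))) (λ a → f (i , a)))))
          (∑-δ m (λ i → ∑[ a < r ] f (i , a)) j)

-- Square matrices with proportional margins

row : ∀ {r} → (Fin r → Fin r → ℤ) → Fin r → ℤ
row {r} D a = ∑[ b < r ] D a b

column : ∀ {r} → (Fin r → Fin r → ℤ) → Fin r → ℤ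
column {r} D b = ∑[ a < r ] D a b

Additive : ∀ {r} → (Fin r → Fin r → ℤ) → Set
Additive D = ∀ a b a′ b′ → D a b + D a′ b′ ≡ D a b′ + D a′ b

module Margins {r : ℕ} (D : Fin r → Fin r → ℤ) (k : ℤ)
               (margins : ∀ a b → row D a + column D b ≡ k * D a b) where

  additive : k ≢ 0ℤ → Additive D
  additive k≢0 a b a′ b′ = ℤ.*-cancelˡ-≡ k _ _ {{ℤ.≢-nonZero k≢0}} (begin
    k * (D a b + D a′ b′)                               ≡⟨ ℤ.*-distribˡ-+ k (D a b) (D a′ b′) ⟩
    k * D a b + k * D a′ b′                             ≡⟨ cong₂ _+_ (margins a b) (margins a′ b′) ⟨
    (row D a + column D b) + (row D a′ + column D b′)   ≡⟨ interchange (row D a) (column D b) (row D a′) (column D b′) ⟩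
    (row D a + column D b′) + (row D a′ + column D b)   ≡⟨ cong₂ _+_ (margins a b′) (margins a′ b) ⟩
    k * D a b′ + k * D a′ b                             ≡⟨ ℤ.*-distribˡ-+ k (D a b′) (D a′ b) ⟨
    k * (D a b′ + D a′ b)                               ∎)
    where
    open ≡-Reasoning
    interchange : ∀ x y z w → (x + y) + (z + w) ≡ (x + w) + (z + y)
    interchange = solve-∀

  rows-vanish : k ≡ 0ℤ → ∀ a → row D a ≡ 0ℤ
  rows-vanish k≡0 a = *-cancel-zero (inhabited⇒≢0 a) (x≡-x⇒x≡0 (begin
    + r * row D a               ≡⟨ ∑-const r (row D a) ⟨
    ∑[ a′ < r ] row D a         ≡⟨ sum-cong-≗ rows-equal ⟨
    ∑[ a′ < r ] row D a′        ≡⟨ ∑-comm D ⟩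
    ∑[ b < r ] column D b       ≡⟨ sum-cong-≗ column≡-row ⟩
    ∑[ b < r ] (- row D a)      ≡⟨ ∑-const r (- row D a) ⟩
    + r * - row D a             ≡⟨ ℤ.neg-distribʳ-* (+ r) (row D a) ⟨
    - (+ r * row D a)           ∎))
    where
    open ≡-Reasoning
    balanced : ∀ a b → row D a + column D b ≡ 0ℤ
    balanced a b = trans (margins a b) (cong (_* D a b) k≡0)
    rows-equal : ∀ a′ → row D a′ ≡ row D a
    rows-equal a′ = ∙-cancelʳ (column D a) _ _ (trans (balanced a′ a) (sym (balanced a a)))
    column≡-row : ∀ b → column D b ≡ - row D a
    column≡-row b = inverseʳ-unique (row D a) (column D b) (balanced a b)

  columns-constant : k ≢ 0ℤ → k ≢ + r → ∀ a a′ b → D a b ≡ D a′ b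
  columns-constant k≢0 k≢r a a′ b = ℤ.i-j≡0⇒i≡j _ _ (*-cancel-zero r-k≢0 (begin
    (+ r - k) * d      ≡⟨ *-distribʳ-− (+ r) k d ⟩
    + r * d - k * d    ≡⟨ cong₂ _-_ via-additivity via-margins ⟨
    Δ - Δ              ≡⟨ ℤ.+-inverseʳ Δ ⟩
    0ℤ                 ∎))
    where
    open ≡-Reasoning
    d = D a b - D a′ b
    Δ = row D a - row D a′
    r-k≢0 : + r - k ≢ 0ℤ
    r-k≢0 r-k≡0 = k≢r (sym (ℤ.i-j≡0⇒i≡j (+ r) k r-k≡0))
    via-additivity : Δ ≡ + r * d
    via-additivity = begin
      Δ                                ≡⟨ ∑-distrib-− r (D a) (D a′) ⟨
      ∑[ b′ < r ] (D a b′ - D a′ b′)   ≡⟨ sum-cong-≗ (λ b′ → +≡+⇒-≡- {D a b′} {D a′ b} {D a b} {D a′ b′}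
                                                                  (additive k≢0 a b′ a′ b)) ⟩
      ∑[ b′ < r ] d                    ≡⟨ ∑-const r d ⟩
      + r * d                          ∎
    via-margins : Δ ≡ k * d
    via-margins = begin
      Δ                                                  ≡⟨ -+-cancel (row D a) (row D a′) (column D b) ⟩
      (row D a + column D b) - (row D a′ + column D b)   ≡⟨ cong₂ _-_ (margins a b) (margins a′ b) ⟩
      k * D a b - k * D a′ b                             ≡⟨ *-distribˡ-− k (D a b) (D a′ b) ⟨
      k * d                                              ∎

  constant-vanishes : k ≢ + 2 * + r → (∀ a b a′ b′ → D a b ≡ D a′ b′) → ∀ a b → D a b ≡ 0ℤ
  constant-vanishes k≢2r const a b = *-cancel-zero 2r-k≢0 (begin
    (+ 2 * + r - k) * D a b                  ≡⟨ double (+ r) k (D a b) ⟩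
    + r * D a b + + r * D a b - k * D a b    ≡⟨ cong₂ (λ u v → u + v - k * D a b) row≡ column≡ ⟨
    row D a + column D b - k * D a b         ≡⟨ cong (_- k * D a b) (margins a b) ⟩
    k * D a b - k * D a b                    ≡⟨ ℤ.+-inverseʳ (k * D a b) ⟩
    0ℤ                                       ∎)
    where
    open ≡-Reasoning
    2r-k≢0 : + 2 * + r - k ≢ 0ℤ
    2r-k≢0 2r-k≡0 = k≢2r (sym (ℤ.i-j≡0⇒i≡j _ k 2r-k≡0))
    double : ∀ r k x → (+ 2 * r - k) * x ≡ r * x + r * x - k * x
    double = solve-∀
    row≡ : row D a ≡ + r * D a b
    row≡ = trans (sum-cong-≗ (λ b′ → const a b′ a b)) (∑-const r (D a b))
    column≡ : column D b ≡ + r * D a b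
    column≡ = trans (sum-cong-≗ (λ a′ → const a′ b a b)) (∑-const r (D a b))

constant : ∀ {r} {D : Fin r → Fin r → ℤ} {k} → (∀ a b → row D a + column D b ≡ k * D a b) →
           k ≢ 0ℤ → k ≢ + r → ∀ a b a′ b′ → D a b ≡ D a′ b′
constant {D = D} {k} margins k≢0 k≢r a b a′ b′ =
  trans (Margins.columns-constant D k margins k≢0 k≢r a a′ b)
        (Margins.columns-constant (λ a b → D b a) k marginsᵀ k≢0 k≢r b b′ a′)
  where
  marginsᵀ : ∀ a b → column D a + row D b ≡ k * D b a
  marginsᵀ a b = trans (ℤ.+-comm (column D a) (row D b)) (margins b a)

module _ {r : ℕ} {D : Fin r → Fin r → ℤ} (additive : Additive D) where

  decompose : ∀ a₀ b₀ a b → D a b ≡ D a b₀ + D a₀ b - D a₀ b₀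
  decompose a₀ b₀ a b = begin
    D a b                          ≡⟨ x≡x+y-y (D a b) (D a₀ b₀) ⟩
    D a b + D a₀ b₀ - D a₀ b₀      ≡⟨ cong (_- D a₀ b₀) (additive a b a₀ b₀) ⟩
    D a b₀ + D a₀ b - D a₀ b₀      ∎
    where
    open ≡-Reasoning
    x≡x+y-y : ∀ x y → x ≡ x + y - y
    x≡x+y-y = solve-∀

  additive-neg : Additive (λ a b → - D a b)
  additive-neg a b a′ b′ = begin
    - D a b + - D a′ b′     ≡⟨ ℤ.neg-distrib-+ (D a b) (D a′ b′) ⟨
    - (D a b + D a′ b′)     ≡⟨ cong -_ (additive a b a′ b′) ⟩
    - (D a b′ + D a′ b)     ≡⟨ ℤ.neg-distrib-+ (D a b′) (D a′ b) ⟩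
    - D a b′ + - D a′ b     ∎
    where open ≡-Reasoning

-- Matrices with entries in {−1, 0, 1}

Trit : ℤ → Set
Trit x = x ≡ 1ℤ ⊎ x ≡ 0ℤ ⊎ x ≡ -1ℤ

IsUnit : ℤ → Set
IsUnit x = x ≡ 1ℤ ⊎ x ≡ -1ℤ

trit⇒unit : ∀ {x} → Trit x → x ≢ 0ℤ → IsUnit x
trit⇒unit (inj₁ x≡1)        _   = inj₁ x≡1
trit⇒unit (inj₂ (inj₁ x≡0)) x≢0 = contradiction x≡0 x≢0
trit⇒unit (inj₂ (inj₂ x≡-1)) _  = inj₂ x≡-1

trit-neg : ∀ {x} → Trit x → Trit (- x)
trit-neg (inj₁ refl)        = inj₂ (inj₂ refl)
trit-neg (inj₂ (inj₁ refl)) = inj₂ (inj₁ refl)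
trit-neg (inj₂ (inj₂ refl)) = inj₁ refl

unit-neg : ∀ {x} → IsUnit x → IsUnit (- x)
unit-neg (inj₁ refl) = inj₂ refl
unit-neg (inj₂ refl) = inj₁ refl

trit-below : ∀ {x} → Trit x → Trit (x + 1ℤ) → x ≡ 0ℤ ⊎ x ≡ -1ℤ
trit-below (inj₁ refl)        (inj₁ ())
trit-below (inj₁ refl)        (inj₂ (inj₁ ()))
trit-below (inj₁ refl)        (inj₂ (inj₂ ()))
trit-below (inj₂ (inj₁ refl)) _ = inj₁ refl
trit-below (inj₂ (inj₂ refl)) _ = inj₂ refl

trit-above : ∀ {x} → Trit x → Trit (-1ℤ + x) → x ≡ 0ℤ ⊎ x ≡ 1ℤ
trit-above (inj₁ refl)        _ = inj₂ refl
trit-above (inj₂ (inj₁ refl)) _ = inj₁ refl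
trit-above (inj₂ (inj₂ refl)) (inj₁ ())
trit-above (inj₂ (inj₂ refl)) (inj₂ (inj₁ ()))
trit-above (inj₂ (inj₂ refl)) (inj₂ (inj₂ ()))

unit-additive : ∀ {w x y z} → IsUnit w → IsUnit x → IsUnit y → IsUnit z →
                w + x ≡ y + z → z ≢ x → y ≡ x
unit-additive _ (inj₁ refl) _ (inj₁ refl) _ z≢x = contradiction refl z≢x
unit-additive _ (inj₂ refl) _ (inj₂ refl) _ z≢x = contradiction refl z≢x
unit-additive (inj₁ refl) (inj₁ refl) (inj₁ refl) (inj₂ refl) () _
unit-additive (inj₁ refl) (inj₁ refl) (inj₂ refl) (inj₂ refl) () _
unit-additive (inj₂ refl) (inj₁ refl) (inj₁ refl) (inj₂ refl) _  _ = refl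
unit-additive (inj₂ refl) (inj₁ refl) (inj₂ refl) (inj₂ refl) () _
unit-additive (inj₁ refl) (inj₂ refl) (inj₁ refl) (inj₁ refl) () _
unit-additive (inj₁ refl) (inj₂ refl) (inj₂ refl) (inj₁ refl) _  _ = refl
unit-additive (inj₂ refl) (inj₂ refl) (inj₁ refl) (inj₁ refl) () _
unit-additive (inj₂ refl) (inj₂ refl) (inj₂ refl) (inj₁ refl) () _

unit≢1 : ∀ {x} → IsUnit x → x ≢ 1ℤ → x ≡ -1ℤ
unit≢1 (inj₁ x≡1)  x≢1 = contradiction x≡1 x≢1
unit≢1 (inj₂ x≡-1) _   = x≡-1

unit≢-1 : ∀ {x} → IsUnit x → x ≢ -1ℤ → x ≡ 1ℤ
unit≢-1 (inj₁ x≡1)  _    = x≡1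
unit≢-1 (inj₂ x≡-1) x≢-1 = contradiction x≡-1 x≢-1

unit-≟1-true : ∀ {x} → IsUnit x → does (x ℤ.≟ 1ℤ) ≡ true → x ≡ 1ℤ
unit-≟1-true (inj₁ refl) _ = refl
unit-≟1-true (inj₂ refl) ()

unit-≟1-false : ∀ {x} → IsUnit x → does (x ℤ.≟ 1ℤ) ≡ false → x ≡ -1ℤ
unit-≟1-false (inj₁ refl) ()
unit-≟1-false (inj₂ refl) _ = refl

bit-below : ∀ {x} → x ≡ 0ℤ ⊎ x ≡ -1ℤ → x ≡ + b2n (does (x ℤ.≟ 0ℤ)) - 1ℤ
bit-below (inj₁ refl) = refl
bit-below (inj₂ refl) = refl

bit-above : ∀ {x} → x ≡ 0ℤ ⊎ x ≡ 1ℤ → x ≡ 1ℤ - + b2n (does (x ℤ.≟ 0ℤ))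
bit-above (inj₁ refl) = refl
bit-above (inj₂ refl) = refl

Nontrivial : ∀ {r} → (Fin r → Bool) → Set
Nontrivial P = (∃[ a ] P a ≡ true) × (∃[ a ] P a ≡ false)

nontrivial-not : ∀ {r} {P : Fin r → Bool} → Nontrivial P → Nontrivial (not ∘ P)
nontrivial-not ((a , Pa) , (a′ , ¬Pa′)) = (a′ , cong not ¬Pa′) , (a , cong not Pa)

module _ {r : ℕ} (D : Fin r → Fin r → ℤ) where

  Vanishing : Set
  Vanishing = ∀ a b → D a b ≡ 0ℤ

  RowSigned : Set
  RowSigned = Σ (Fin r → Bool) λ P → Nontrivial P ×
    (∀ a b → (P a ≡ true → D a b ≡ 1ℤ) × (P a ≡ false → D a b ≡ -1ℤ))

  IndicatorDifference : Set
  IndicatorDifference = Σ (Fin r → Bool) λ P → Σ (Fin r → Bool) λ Q →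
    Nontrivial P × Nontrivial Q × (∀ a b → D a b ≡ + b2n (P a) - + b2n (Q b))

-- For a block of S, −Dᵀ is the block of the same two parts taken in the opposite order.
ColumnSigned : ∀ {r} → (Fin r → Fin r → ℤ) → Set
ColumnSigned D = RowSigned (λ a b → - D b a)

sign-split : ∀ {n} (f : Fin (suc n) → ℤ) → (∀ a → IsUnit (f a)) → ∑[ a < suc n ] f a ≡ 0ℤ →
  Σ (Fin (suc n) → Bool) λ P → Nontrivial P ×
    (∀ a → (P a ≡ true → f a ≡ 1ℤ) × (P a ≡ false → f a ≡ -1ℤ))
sign-split f unit ∑≡0 =
  (λ a → does (f a ℤ.≟ 1ℤ)) , (positive , negative) ,
  λ a → unit-≟1-true (unit a) , unit-≟1-false (unit a)
  where
  positive : ∃[ a ] does (f a ℤ.≟ 1ℤ) ≡ true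
  positive with any? (λ a → f a ℤ.≟ 1ℤ)
  ... | yes (a , fa≡1) = a , dec-true (f a ℤ.≟ 1ℤ) fa≡1
  ... | no ∄ = contradiction ∑≡0 (∑-const-≢0 (λ ()) (λ a → unit≢1 (unit a) (∄ ∘ (a ,_))))
  negative : ∃[ a ] does (f a ℤ.≟ 1ℤ) ≡ false
  negative with any? (λ a → f a ℤ.≟ -1ℤ)
  ... | yes (a , fa≡-1) = a , dec-false (f a ℤ.≟ 1ℤ) (λ fa≡1 → -1≢1 (trans (sym fa≡-1) fa≡1))
    where
    -1≢1 : -1ℤ ≢ 1ℤ
    -1≢1 ()
  ... | no ∄ = contradiction ∑≡0 (∑-const-≢0 (λ ()) (λ a → unit≢-1 (unit a) (∄ ∘ (a ,_))))

row-signed : ∀ {n} (D : Fin (suc n) → Fin (suc n) → ℤ) → (∀ a b → IsUnit (D a b)) →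
             (∀ a b → D a b ≡ D a zero) → column D zero ≡ 0ℤ → RowSigned D
row-signed D unit rows-constant column≡0
  with sign-split (λ a → D a zero) (λ a → unit a zero) column≡0
... | P , nontrivial , sign = P , nontrivial , λ a b →
  (λ Pa → trans (rows-constant a b) (proj₁ (sign a) Pa)) ,
  (λ ¬Pa → trans (rows-constant a b) (proj₂ (sign a) ¬Pa))

rows-or-columns-constant : ∀ {n} {D : Fin (suc n) → Fin (suc n) → ℤ} → Additive D →
  (∀ a b → IsUnit (D a b)) → (∀ a b → D a b ≡ D a zero) ⊎ (∀ a b → D a b ≡ D zero b)
rows-or-columns-constant {D = D} additive unit
  with any? (λ b → ¬? (D zero b ℤ.≟ D zero zero))
... | no ∄ = inj₁ λ a b → begin
  D a b                                 ≡⟨ decompose {D = D} additive zero zero a b ⟩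
  D a zero + D zero b - D zero zero     ≡⟨ cong (λ v → D a zero + v - D zero zero) (row₀-constant b) ⟩
  D a zero + D zero zero - D zero zero  ≡⟨ x+y-y≡x (D a zero) (D zero zero) ⟩
  D a zero                              ∎
  where
  open ≡-Reasoning
  row₀-constant : ∀ b → D zero b ≡ D zero zero
  row₀-constant b = decidable-stable (D zero b ℤ.≟ D zero zero) (∄ ∘ (b ,_))
  x+y-y≡x : ∀ x y → x + y - y ≡ x
  x+y-y≡x = solve-∀
... | yes (b₁ , D₀₁≢D₀₀) = inj₂ λ a b → begin
  D a b                                 ≡⟨ decompose {D = D} additive zero zero a b ⟩
  D a zero + D zero b - D zero zero     ≡⟨ cong (λ v → v + D zero b - D zero zero) (column₀-constant a) ⟩
  D zero zero + D zero b - D zero zero  ≡⟨ y+x-y≡x (D zero b) (D zero zero) ⟩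
  D zero b                              ∎
  where
  open ≡-Reasoning
  column₀-constant : ∀ a → D a zero ≡ D zero zero
  column₀-constant a = unit-additive (unit a b₁) (unit zero zero) (unit a zero) (unit zero b₁)
                              (additive a b₁ zero zero) D₀₁≢D₀₀
  y+x-y≡x : ∀ x y → y + x - y ≡ x
  y+x-y≡x = solve-∀

indicator-difference : ∀ {r} {D : Fin r → Fin r → ℤ} → Additive D → (∀ a b → Trit (D a b)) →
  ∀ {a₀ a₁ b₀ b₁} → D a₀ b₀ ≡ 0ℤ → D a₀ b₁ ≡ 1ℤ → D a₁ b₁ ≡ 0ℤ → IndicatorDifference D
indicator-difference {r} {D} additive trit {a₀} {a₁} {b₀} {b₁} D₀₀≡0 D₀₁≡1 D₁₁≡0 =
  P , Q ,
  ((a₀ , dec-true (ρ a₀ ℤ.≟ 0ℤ) D₀₀≡0) , (a₁ , dec-false (ρ a₁ ℤ.≟ 0ℤ) (-1≢0 ∘ trans (sym ρ₁≡-1)))) ,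
  ((b₀ , dec-true (σ b₀ ℤ.≟ 0ℤ) D₀₀≡0) , (b₁ , dec-false (σ b₁ ℤ.≟ 0ℤ) (1≢0 ∘ trans (sym D₀₁≡1)))) ,
  λ a b → begin
    D a b                                     ≡⟨ split a b ⟩
    ρ a + σ b                                 ≡⟨ cong₂ _+_ (bit-below (ρ-values a))
                                                               (bit-above (σ-values b)) ⟩
    (+ b2n (P a) - 1ℤ) + (1ℤ - + b2n (Q b))   ≡⟨ telescope (+ b2n (P a)) (+ b2n (Q b)) ⟩
    + b2n (P a) - + b2n (Q b)                 ∎
  where
  open ≡-Reasoning
  ρ σ : Fin r → ℤ
  ρ a = D a b₀
  σ b = D a₀ b
  P Q : Fin r → Bool
  P a = does (ρ a ℤ.≟ 0ℤ)
  Q b = does (σ b ℤ.≟ 0ℤ)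
  -1≢0 : -1ℤ ≢ 0ℤ
  -1≢0 ()
  1≢0 : 1ℤ ≢ 0ℤ
  1≢0 ()
  telescope : ∀ p q → (p - 1ℤ) + (1ℤ - q) ≡ p - q
  telescope = solve-∀
  split : ∀ a b → D a b ≡ ρ a + σ b
  split a b = trans (decompose {D = D} additive a₀ b₀ a b)
                    (trans (cong (λ v → ρ a + σ b - v) D₀₀≡0) (ℤ.+-identityʳ (ρ a + σ b)))
  ρ₁≡-1 : ρ a₁ ≡ -1ℤ
  ρ₁≡-1 = ∙-cancelʳ 1ℤ _ _ (trans (sym (trans (split a₁ b₁) (cong (_+_ (ρ a₁)) D₀₁≡1))) D₁₁≡0)
  ρ-values : ∀ a → ρ a ≡ 0ℤ ⊎ ρ a ≡ -1ℤ
  ρ-values a = trit-below (trit a b₀)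
    (subst Trit (trans (split a b₁) (cong (_+_ (ρ a)) D₀₁≡1)) (trit a b₁))
  σ-values : ∀ b → σ b ≡ 0ℤ ⊎ σ b ≡ 1ℤ
  σ-values b = trit-above (trit a₀ b)
    (subst Trit (trans (split a₁ b) (cong (_+ σ b) ρ₁≡-1)) (trit a₁ b))

indicator-difference-neg : ∀ {r} {D : Fin r → Fin r → ℤ} →
  IndicatorDifference (λ a b → - D a b) → IndicatorDifference D
indicator-difference-neg {D = D} (P , Q , P-nontrivial , Q-nontrivial , shape) =
  not ∘ P , not ∘ Q , nontrivial-not P-nontrivial , nontrivial-not Q-nontrivial , λ a b → begin
    D a b                                  ≡⟨ ℤ.neg-involutive (D a b) ⟨
    - - D a b                              ≡⟨ cong -_ (shape a b) ⟩
    - (+ b2n (P a) - + b2n (Q b))          ≡⟨ negate (P a) (Q b) ⟩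
    + b2n (not (P a)) - + b2n (not (Q b))  ∎
  where
  open ≡-Reasoning
  negate : ∀ p q → - (+ b2n p - + b2n q) ≡ + b2n (not p) - + b2n (not q)
  negate false false = refl
  negate false true  = refl
  negate true  false = refl
  negate true  true  = refl

module Classification {n : ℕ} (D : Fin (suc n) → Fin (suc n) → ℤ)
  (margins : ∀ a b → row D a + column D b ≡ + suc n * D a b)
  (trit : ∀ a b → Trit (D a b))
  (zeros : ∀ a b → count (λ b′ → D a b′ ℤ.≟ 0ℤ) ≡ count (λ a′ → D a′ b ℤ.≟ 0ℤ)) where

  private
    r = suc n

    additive : Additive D
    additive = Margins.additive D (+ r) margins (λ ())

    zero? : ∀ a b → Dec (D a b ≡ 0ℤ)
    zero? a b = D a b ℤ.≟ 0ℤ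

    e : ℕ
    e = count (zero? zero)

    row-zeros : ∀ a → count (zero? a) ≡ e
    row-zeros a = trans (zeros a zero) (sym (zeros zero zero))

    column-zeros : ∀ b → count (λ a → zero? a b) ≡ e
    column-zeros b = sym (zeros zero b)

    units : (∀ a b → D a b ≢ 0ℤ) → ∀ a b → IsUnit (D a b)
    units nonzero a b = trit⇒unit (trit a b) (nonzero a b)

  rows-constant⇒row-signed : (∀ a b → IsUnit (D a b)) → (∀ a b → D a b ≡ D a zero) → RowSigned D
  rows-constant⇒row-signed unit rows-constant = row-signed D unit rows-constant
    (identityʳ-unique (row D zero) (column D zero) (trans (margins zero zero) (sym row₀≡)))
    where
    row₀≡ : row D zero ≡ + r * D zero zero
    row₀≡ = trans (sum-cong-≗ (rows-constant zero)) (∑-const r (D zero zero))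

  columns-constant⇒column-signed : (∀ a b → IsUnit (D a b)) → (∀ a b → D a b ≡ D zero b) →
                                   ColumnSigned D
  columns-constant⇒column-signed unit columns-constant = row-signed (λ a b → - D b a)
    (λ a b → unit-neg (unit b a)) (λ a b → cong -_ (columns-constant b a))
    (trans (∑-neg r (D zero)) (cong -_ row₀≡0))
    where
    column₀≡ : column D zero ≡ + r * D zero zero
    column₀≡ = trans (sum-cong-≗ (λ a → columns-constant a zero)) (∑-const r (D zero zero))
    row₀≡0 : row D zero ≡ 0ℤ
    row₀≡0 = identityʳ-unique (column D zero) (row D zero)
      (trans (ℤ.+-comm (column D zero) (row D zero)) (trans (margins zero zero) (sym column₀≡)))

  signed : (∀ a b → D a b ≢ 0ℤ) → RowSigned D ⊎ ColumnSigned D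
  signed nonzero with rows-or-columns-constant additive (units nonzero)
  ... | inj₁ rows-constant    = inj₁ (rows-constant⇒row-signed (units nonzero) rows-constant)
  ... | inj₂ columns-constant = inj₂ (columns-constant⇒column-signed (units nonzero) columns-constant)

  -- Negating D reverses the one-way arcs between the two parts; so D a₀ b₁ = 1 may be assumed.
  mixed : e ≢ 0 → e ≢ r → IndicatorDifference D
  mixed e≢0 e≢r with count≢0⇒some (zero? zero) e≢0 | count≢n⇒some-not (zero? zero) e≢r
  ... | b₀ , D₀₀≡0 | b₁ , D₀₁≢0
    with count≢0⇒some (λ a → zero? a b₁) (e≢0 ∘ trans (sym (column-zeros b₁)))
  ...   | a₁ , D₁₁≡0 with trit⇒unit (trit zero b₁) D₀₁≢0
  ...     | inj₁ D₀₁≡1  = indicator-difference additive trit D₀₀≡0 D₀₁≡1 D₁₁≡0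
  ...     | inj₂ D₀₁≡-1 = indicator-difference-neg
    (indicator-difference (additive-neg {D = D} additive) (λ a b → trit-neg (trit a b))
                          (cong -_ D₀₀≡0) (cong -_ D₀₁≡-1) (cong -_ D₁₁≡0))

  classify : Vanishing D ⊎ (RowSigned D ⊎ ColumnSigned D) ⊎ IndicatorDifference D
  classify with e ℕ.≟ 0 | e ℕ.≟ r
  ... | yes e≡0 | _       = inj₂ (inj₁ (signed λ a → count≡0⇒none (zero? a) (trans (row-zeros a) e≡0)))
  ... | no _    | yes e≡r = inj₁ λ a → count≡n⇒all (zero? a) (trans (row-zeros a) e≡r)
  ... | no e≢0  | no e≢r  = inj₂ (inj₂ (mixed e≢0 e≢r))

b2n-∨ : ∀ p q → + b2n (p ∨ q) ≡ + b2n (p ∧ q) + + b2n (p ∧ not q) + + b2n (q ∧ not p)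
b2n-∨ false false = refl
b2n-∨ false true  = refl
b2n-∨ true  false = refl
b2n-∨ true  true  = refl

b2n-skew : ∀ p q → + b2n p - + b2n q ≡ + b2n (p ∧ not q) - + b2n (q ∧ not p)
b2n-skew false false = refl
b2n-skew false true  = refl
b2n-skew true  false = refl
b2n-skew true  true  = refl

b2n-not : ∀ b → + b2n b + + b2n (not b) ≡ 1ℤ
b2n-not false = refl
b2n-not true  = refl

b2n-idem : ∀ b → + b2n b * + b2n b ≡ + b2n b
b2n-idem false = refl
b2n-idem true  = refl

skew-trit : ∀ p q → Trit (+ b2n p - + b2n q)
skew-trit false false = inj₂ (inj₁ refl)
skew-trit false true  = inj₂ (inj₂ refl)
skew-trit true  false = inj₁ refl
skew-trit true  true  = inj₂ (inj₁ refl)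

skew≡1 : ∀ {p q} → + b2n p - + b2n q ≡ 1ℤ → (p ∧ not q) ≡ true
skew≡1 {true}  {false} _ = refl
skew≡1 {true}  {true}  ()
skew≡1 {false} {true}  ()
skew≡1 {false} {false} ()

skew≡-1 : ∀ {p q} → + b2n p - + b2n q ≡ -1ℤ → (q ∧ not p) ≡ true
skew≡-1 {false} {true}  _ = refl
skew≡-1 {true}  {true}  ()
skew≡-1 {true}  {false} ()
skew≡-1 {false} {false} ()

skew≡0 : ∀ {p q} → + b2n p - + b2n q ≡ 0ℤ → (p ∧ not q) ≡ false
skew≡0 {true}  {true}  _ = refl
skew≡0 {false} {false} _ = refl
skew≡0 {true}  {false} ()
skew≡0 {false} {true}  ()

∧≡skew≟0 : ∀ {p q} → (p ∨ q) ≡ true → (p ∧ q) ≡ does (+ b2n p - + b2n q ℤ.≟ 0ℤ)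
∧≡skew≟0 {true}  {true}  _ = refl
∧≡skew≟0 {true}  {false} _ = refl
∧≡skew≟0 {false} {true}  _ = refl
∧≡skew≟0 {false} {false} ()

≡skew≢-1 : ∀ {p q} → (p ∨ q) ≡ true → p ≡ not (does (+ b2n p - + b2n q ℤ.≟ -1ℤ))
≡skew≢-1 {true}  {true}  _ = refl
≡skew≢-1 {true}  {false} _ = refl
≡skew≢-1 {false} {true}  _ = refl
≡skew≢-1 {false} {false} ()

-- The doubly regular equations at a single entry

apart-entry : ∀ t d α β γ η {I u v w} → I ≡ 0ℤ → w + u + v ≡ 1ℤ →
  t * d * I + α * u + β * v + γ * w + η * (1ℤ - I - u - v - w) ≡ α * u + β * v + γ * w
apart-entry t d α β γ η {u = u} {v} {w} refl w+u+v≡1 = begin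
  t * d * 0ℤ + α * u + β * v + γ * w + η * (1ℤ - 0ℤ - u - v - w)
    ≡⟨ cong (λ c → t * d * 0ℤ + α * u + β * v + γ * w + η * (c - 0ℤ - u - v - w)) w+u+v≡1 ⟨
  t * d * 0ℤ + α * u + β * v + γ * w + η * (w + u + v - 0ℤ - u - v - w)
    ≡⟨ cancel t d α β γ η u v w ⟩
  α * u + β * v + γ * w ∎
  where
  open ≡-Reasoning
  cancel : ∀ t d α β γ η u v w →
    t * d * 0ℤ + α * u + β * v + γ * w + η * (w + u + v - 0ℤ - u - v - w) ≡ α * u + β * v + γ * w
  cancel = solve-∀

diagonal-entry : ∀ t α β γ η {I u v w} → I ≡ 1ℤ → u ≡ 0ℤ → v ≡ 0ℤ → w ≡ 0ℤ →
  t * 1ℤ * I + α * u + β * v + γ * w + η * (1ℤ - I - u - v - w) ≡ t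
diagonal-entry t α β γ η refl refl refl refl = cancel t α β γ η
  where
  cancel : ∀ t α β γ η →
    t * 1ℤ * 1ℤ + α * 0ℤ + β * 0ℤ + γ * 0ℤ + η * (1ℤ - 1ℤ - 0ℤ - 0ℤ - 0ℤ) ≡ t
  cancel = solve-∀

one-way-free-entry : ∀ t d α β α′ β′ γ η {I u v w} → u ≡ 0ℤ → v ≡ 0ℤ →
  t * d * I + α * u + β * v + γ * w + η * (1ℤ - I - u - v - w)
  ≡ t * d * I + α′ * u + β′ * v + γ * w + η * (1ℤ - I - u - v - w)
one-way-free-entry t d α β α′ β′ γ η {I} {w = w} refl refl = cancel t d α β α′ β′ γ η I w
  where
  cancel : ∀ t d α β α′ β′ γ η I w →
    t * d * I + α * 0ℤ + β * 0ℤ + γ * w + η * (1ℤ - I - 0ℤ - 0ℤ - w)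
    ≡ t * d * I + α′ * 0ℤ + β′ * 0ℤ + γ * w + η * (1ℤ - I - 0ℤ - 0ℤ - w)
  cancel = solve-∀

commutator-summand : ∀ a a′ b b′ c d →
  (a - a′) * (d + b′ + b) + (b′ - b) * (c + a′ + a)
  ≡ (a * d + + 2 * (a * b′) + c * b′) - (b * c + + 2 * (b * a′) + d * a′)
commutator-summand = solve-∀

commutator-apart : ∀ α₁ α₂ β₁ β₂ γ₁ γ₂ u v w →
  ((α₁ * u + β₁ * v + γ₁ * w) + + 2 * (α₂ * u + β₂ * v + γ₂ * w) + (α₁ * u + β₁ * v + γ₁ * w))
  - ((α₁ * v + β₁ * u + γ₁ * w) + + 2 * (α₂ * v + β₂ * u + γ₂ * w) + (α₁ * v + β₁ * u + γ₁ * w))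
  ≡ - (+ 2 * (β₁ + β₂ - α₁ - α₂)) * (u - v)
commutator-apart = solve-∀

without-one-way-arcs : ∀ {m r} {Γ : Digraph (Vtx m r)} {p : DRParams Γ} →
  (∀ x y → oneArc Γ x y ≡ false) →
  SatisfiesDR Γ p → SatisfiesDR Γ (record p { α = λ _ → 0ℤ ; β = λ _ → 0ℤ })
without-one-way-arcs {Γ = Γ} {p} none dr i j x y = trans (dr i j x y)
  (one-way-free-entry t (δ₀ Γ s) (α s) (β s) 0ℤ 0ℤ (γ s) (η s)
    (cong (λ b → + b2n b) (none x y)) (cong (λ b → + b2n b) (none y x)))
  where
  open DRParams p
  s = idx Γ i j

module TeamDigraph {m r : ℕ} (Γ : Digraph (Vtx m r))
  (within : ∀ i a b → arc Γ (i , a) (i , b) ≡ false)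
  (across : ∀ i j a b → i ≢ j → (arc Γ (i , a) (j , b) ∨ arc Γ (j , b) (i , a)) ≡ true) where

  V : Set
  V = Vtx m r

  Apart : V → V → Set
  Apart x y = proj₁ x ≢ proj₁ y

  A₀ A₁ K S : V → V → ℤ
  A₀ x y = + Amat Γ zero x y
  A₁ x y = + Amat Γ (suc zero) x y
  K x y = + b2n (arc Γ x y ∨ arc Γ y x)
  S x y = + b2n (arc Γ x y) - + b2n (arc Γ y x)

  block : Fin m → Fin m → Fin r → Fin r → ℤ
  block i j a b = S (i , a) (j , b)

  adjacent⇔apart : ∀ x y → (arc Γ x y ∨ arc Γ y x) ≡ not (does (proj₁ x ≟ proj₁ y))
  adjacent⇔apart (i , a) (j , b) with i ≟ j
  ... | yes refl rewrite within i a b | within i b a = refl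
  ... | no i≢j = across i j a b i≢j

  K≡A₀+A₁+A₁ᵀ : ∀ x y → K x y ≡ A₀ x y + A₁ x y + A₁ y x
  K≡A₀+A₁+A₁ᵀ x y = b2n-∨ (arc Γ x y) (arc Γ y x)

  S≡A₁-A₁ᵀ : ∀ x y → S x y ≡ A₁ x y - A₁ y x
  S≡A₁-A₁ᵀ x y = b2n-skew (arc Γ x y) (arc Γ y x)

  A₀-sym : ∀ x y → A₀ x y ≡ A₀ y x
  A₀-sym x y = cong (λ b → + b2n b) (∧-comm (arc Γ x y) (arc Γ y x))

  adjacent : ∀ {x y} → Apart x y → (arc Γ x y ∨ arc Γ y x) ≡ true
  adjacent {x} {y} x≁y = trans (adjacent⇔apart x y) (cong not (dec-false (proj₁ x ≟ proj₁ y) x≁y))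

  K-apart : ∀ {x y} → Apart x y → K x y ≡ 1ℤ
  K-apart {x} {y} x≁y = cong (λ b → + b2n b) (adjacent {x} {y} x≁y)

  ∑ᵥ-split : ∀ (f : V → ℤ) y → ∑ᵥ f ≡ ∑[ b < r ] f (proj₁ y , b) + ∑ᵥ (λ z → f z * K z y)
  ∑ᵥ-split f y = begin
    ∑ᵥ f                                                 ≡⟨ ∑ᵥ-cong partition ⟩
    ∑ᵥ (λ z → f z * same z + f z * K z y)                ≡⟨ ∑ᵥ-distrib-+ (λ z → f z * same z) fK ⟩
    ∑ᵥ (λ z → f z * same z) + ∑ᵥ fK                      ≡⟨ cong (_+ ∑ᵥ fK) (∑ᵥ-part f (proj₁ y)) ⟩
    ∑[ b < r ] f (proj₁ y , b) + ∑ᵥ (λ z → f z * K z y)  ∎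
    where
    open ≡-Reasoning
    same fK : V → ℤ
    same z = + b2n (does (proj₁ z ≟ proj₁ y))
    fK z = f z * K z y
    partition : ∀ z → f z ≡ f z * same z + f z * K z y
    partition z = begin
      f z                         ≡⟨ ℤ.*-identityʳ (f z) ⟨
      f z * 1ℤ                    ≡⟨ cong (f z *_) (b2n-not (does (proj₁ z ≟ proj₁ y))) ⟨
      f z * (same z + + b2n (not (does (proj₁ z ≟ proj₁ y))))
                                  ≡⟨ cong (λ b → f z * (same z + + b2n b)) (adjacent⇔apart z y) ⟨
      f z * (same z + K z y)      ≡⟨ ℤ.*-distribˡ-+ (f z) (same z) (K z y) ⟩
      f z * same z + f z * K z y  ∎

  S-trit : ∀ x y → Trit (S x y)
  S-trit x y = skew-trit (arc Γ x y) (arc Γ y x)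

  S≡1⇒oneArc : ∀ {x y} → S x y ≡ 1ℤ → oneArc Γ x y ≡ true
  S≡1⇒oneArc {x} {y} = skew≡1 {arc Γ x y} {arc Γ y x}

  S≡-1⇒oneArc : ∀ {x y} → S x y ≡ -1ℤ → oneArc Γ y x ≡ true
  S≡-1⇒oneArc {x} {y} = skew≡-1 {arc Γ x y} {arc Γ y x}

  S≡0⇒¬oneArc : ∀ {x y} → S x y ≡ 0ℤ → oneArc Γ x y ≡ false
  S≡0⇒¬oneArc {x} {y} = skew≡0 {arc Γ x y} {arc Γ y x}

  symArc≡S≟0 : ∀ {x y} → Apart x y → symArc Γ x y ≡ does (S x y ℤ.≟ 0ℤ)
  symArc≡S≟0 {x} {y} x≁y = ∧≡skew≟0 {arc Γ x y} {arc Γ y x} (adjacent {x} {y} x≁y)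

  S≡0⇒symArc : ∀ {x y} → Apart x y → S x y ≡ 0ℤ → symArc Γ x y ≡ true
  S≡0⇒symArc {x} {y} x≁y S≡0 = trans (symArc≡S≟0 {x} {y} x≁y) (dec-true (S x y ℤ.≟ 0ℤ) S≡0)

  arc≡S≢-1 : ∀ {x y} → Apart x y → arc Γ x y ≡ not (does (S x y ℤ.≟ -1ℤ))
  arc≡S≢-1 {x} {y} x≁y = ≡skew≢-1 {arc Γ x y} {arc Γ y x} (adjacent {x} {y} x≁y)

  Imat-apart : ∀ {x y} → Apart x y → Imat Γ x y ≡ 0
  Imat-apart {x} {y} x≁y =
    cong b2n (trans (isYes≗does (x ≟v y)) (dec-false (x ≟v y) (x≁y ∘ cong proj₁)))

  Imat-diagonal : ∀ x → Imat Γ x x ≡ 1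
  Imat-diagonal x = cong b2n (trans (isYes≗does (x ≟v x)) (dec-true (x ≟v x) refl))

  inFrom : V → Fin m → ℕ
  inFrom x j = ∑ r (λ b → b2n (oneArc Γ (j , b) x))

  row-flow : ∀ x j → ∑[ b < r ] S x (j , b) ≡ + outTo Γ x j - + inFrom x j
  row-flow x j = begin
    ∑[ b < r ] S x (j , b)                              ≡⟨ sum-cong-≗ (λ b → S≡A₁-A₁ᵀ x (j , b)) ⟩
    ∑[ b < r ] (A₁ x (j , b) - A₁ (j , b) x)            ≡⟨ ∑-distrib-− r (λ b → A₁ x (j , b)) (λ b → A₁ (j , b) x) ⟩
    ∑[ b < r ] A₁ x (j , b) - ∑[ b < r ] A₁ (j , b) x   ≡⟨ cong₂ _-_ (pos-∑ r _) (pos-∑ r _) ⟨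
    + outTo Γ x j - + inFrom x j                        ∎
    where open ≡-Reasoning

  team-sum : ∀ {i j} → i ≢ j → ∀ a →
    symTo Γ (i , a) j ℕ.+ outTo Γ (i , a) j ℕ.+ inFrom (i , a) j ≡ r
  team-sum {i} {j} i≢j a = ℤ.+-injective (begin
    + symTo Γ x j + + outTo Γ x j + + inFrom x j
      ≡⟨ cong₂ _+_ (cong₂ _+_ (pos-∑ r _) (pos-∑ r _)) (pos-∑ r _) ⟩
    ∑[ b < r ] A₀ x (j , b) + ∑[ b < r ] A₁ x (j , b) + ∑[ b < r ] A₁ (j , b) x
      ≡⟨ cong (_+ ∑[ b < r ] A₁ (j , b) x)
              (∑-distrib-+ (λ b → A₀ x (j , b)) (λ b → A₁ x (j , b))) ⟨
    ∑[ b < r ] (A₀ x (j , b) + A₁ x (j , b)) + ∑[ b < r ] A₁ (j , b) x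
      ≡⟨ ∑-distrib-+ (λ b → A₀ x (j , b) + A₁ x (j , b)) (λ b → A₁ (j , b) x) ⟨
    ∑[ b < r ] (A₀ x (j , b) + A₁ x (j , b) + A₁ (j , b) x)
      ≡⟨ sum-cong-≗ (λ b → trans (sym (K≡A₀+A₁+A₁ᵀ x (j , b))) (K-apart i≢j)) ⟩
    ∑[ b < r ] 1ℤ
      ≡⟨ trans (∑-const r 1ℤ) (ℤ.*-identityʳ (+ r)) ⟩
    + r ∎)
    where
    open ≡-Reasoning
    x = (i , a)

  vanishing⇒CaseA : ∀ {i j} → i ≢ j → Vanishing (block i j) → CaseA Γ i j
  vanishing⇒CaseA {i} {j} i≢j vanishing a b = S≡0⇒symArc {i , a} {j , b} i≢j (vanishing a b)

  rowSigned⇒CaseB : ∀ {i j} → RowSigned (block i j) → CaseB Γ i j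
  rowSigned⇒CaseB {i} {j} (P , nontrivial , sign) = P , nontrivial , λ a b →
    (λ Pa → S≡1⇒oneArc {i , a} {j , b} (proj₁ (sign a b) Pa)) ,
    (λ ¬Pa → S≡-1⇒oneArc {i , a} {j , b} (proj₂ (sign a b) ¬Pa))

  columnSigned⇒CaseB : ∀ {i j} → ColumnSigned (block i j) → CaseB Γ j i
  columnSigned⇒CaseB {i} {j} (P , nontrivial , sign) = P , nontrivial , λ a b →
    (λ Pa → S≡-1⇒oneArc {i , b} {j , a} (-x≡y⇒x≡-y (proj₁ (sign a b) Pa))) ,
    (λ ¬Pa → S≡1⇒oneArc {i , b} {j , a} (-x≡y⇒x≡-y (proj₂ (sign a b) ¬Pa)))

  indicatorDifference⇒CaseC : ∀ {i j} → i ≢ j → IndicatorDifference (block i j) → CaseC Γ i j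
  indicatorDifference⇒CaseC {i} {j} i≢j (P , Q , P-nontrivial , Q-nontrivial , shape) =
    P , Q , P-nontrivial , Q-nontrivial , λ a b →
      (λ Pa Qb → S≡0⇒symArc {i , a} {j , b} i≢j (value a b Pa Qb)) ,
      (λ ¬Pa ¬Qb → S≡0⇒symArc {i , a} {j , b} i≢j (value a b ¬Pa ¬Qb)) ,
      (λ Pa ¬Qb → S≡1⇒oneArc {i , a} {j , b} (value a b Pa ¬Qb)) ,
      (λ Qb ¬Pa → S≡-1⇒oneArc {i , a} {j , b} (value a b ¬Pa Qb))
    where
    value : ∀ a b {p q} → P a ≡ p → Q b ≡ q → block i j a b ≡ + b2n p - + b2n q
    value a b Pa Qb = trans (shape a b) (cong₂ (λ p q → + b2n p - + b2n q) Pa Qb)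

  block-cases : ∀ {i j} → i ≢ j →
    Vanishing (block i j) ⊎ (RowSigned (block i j) ⊎ ColumnSigned (block i j)) ⊎
      IndicatorDifference (block i j) →
    CaseA Γ i j ⊎ (CaseB Γ i j ⊎ CaseB Γ j i) ⊎ CaseC Γ i j
  block-cases i≢j (inj₁ vanishing)            = inj₁ (vanishing⇒CaseA i≢j vanishing)
  block-cases i≢j (inj₂ (inj₁ (inj₁ signed))) = inj₂ (inj₁ (inj₁ (rowSigned⇒CaseB signed)))
  block-cases i≢j (inj₂ (inj₁ (inj₂ signed))) = inj₂ (inj₁ (inj₂ (columnSigned⇒CaseB signed)))
  block-cases i≢j (inj₂ (inj₂ indicators))    = inj₂ (inj₂ (indicatorDifference⇒CaseC i≢j indicators))

-- Doubly regular teams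

module DoublyRegularTeam {m n : ℕ} (Γ : Digraph (Vtx m (suc n)))
  (within : ∀ i a b → arc Γ (i , a) (i , b) ≡ false)
  (across : ∀ i j a b → i ≢ j → (arc Γ (i , a) (j , b) ∨ arc Γ (j , b) (i , a)) ≡ true)
  {k : ℕ} (regular : ∀ x → outdeg Γ x ≡ k × indeg Γ x ≡ k)
  (p : DRParams Γ) (dr : SatisfiesDR Γ p) where

  open TeamDigraph Γ within across
  open DRParams p

  P : Fin 2 → Fin 2 → V → V → ℤ
  P i j x y = + prodEntry Γ i j x y

  κ : ℤ
  κ = keyValue Γ p

  P≡∑ : ∀ i j x y → P i j x y ≡ ∑ᵥ (λ z → + Amat Γ i x z * + Amat Γ j z y)
  P≡∑ i j x y = trans (pos-∑ᵥ (λ z → Amat Γ i x z ℕ.* Amat Γ j z y))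
                      (∑ᵥ-cong (λ z → ℤ.pos-* (Amat Γ i x z) (Amat Γ j z y)))

  P-apart : ∀ i j {x y} → Apart x y →
    P i j x y ≡ α (idx Γ i j) * A₁ x y + β (idx Γ i j) * A₁ y x + γ (idx Γ i j) * A₀ x y
  P-apart i j {x} {y} x≁y = trans (dr i j x y)
    (apart-entry t (δ₀ Γ s) (α s) (β s) (γ s) (η s) (cong +_ (Imat-apart {x} {y} x≁y))
                 (trans (sym (K≡A₀+A₁+A₁ᵀ x y)) (K-apart {x} {y} x≁y)))
    where s = idx Γ i j

  P₀₀-diagonal : ∀ x → P zero zero x x ≡ t
  P₀₀-diagonal x@(i , a) = trans (dr zero zero x x)
    (diagonal-entry t (α zero) (β zero) (γ zero) (η zero) (cong +_ (Imat-diagonal x))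
                    no-loop no-loop (cong (λ b → + b2n (b ∧ b)) (within i a a)))
    where
    no-loop : A₁ x x ≡ 0ℤ
    no-loop = cong (λ b → + b2n (b ∧ not b)) (within i a a)

  S-row-sum : ∀ x → ∑ᵥ (S x) ≡ 0ℤ
  S-row-sum x = begin
    ∑ᵥ (S x)                   ≡⟨ ∑ᵥ-distrib-− (λ z → + b2n (arc Γ x z)) (λ z → + b2n (arc Γ z x)) ⟩
    _                          ≡⟨ cong₂ _-_ (pos-∑ᵥ (λ z → b2n (arc Γ x z))) (pos-∑ᵥ (λ z → b2n (arc Γ z x))) ⟨
    + outdeg Γ x - + indeg Γ x ≡⟨ ℤ.i≡j⇒i-j≡0 (cong +_ (trans (proj₁ (regular x)) (sym (proj₂ (regular x))))) ⟩
    0ℤ                         ∎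
    where open ≡-Reasoning

  S-column-sum : ∀ y → ∑ᵥ (λ z → S z y) ≡ 0ℤ
  S-column-sum y = begin
    ∑ᵥ (λ z → S z y)           ≡⟨ ∑ᵥ-distrib-− (λ z → + b2n (arc Γ z y)) (λ z → + b2n (arc Γ y z)) ⟩
    _                          ≡⟨ cong₂ _-_ (pos-∑ᵥ (λ z → b2n (arc Γ z y))) (pos-∑ᵥ (λ z → b2n (arc Γ y z))) ⟨
    + indeg Γ y - + outdeg Γ y ≡⟨ ℤ.i≡j⇒i-j≡0 (cong +_ (trans (proj₂ (regular y)) (sym (proj₁ (regular y))))) ⟩
    0ℤ                         ∎
    where open ≡-Reasoning

  R : V → V → ℤ
  R x y = P (suc zero) zero x y + + 2 * P (suc zero) (suc zero) x y + P zero (suc zero) x y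

  R≡∑ : ∀ x y → R x y ≡ ∑ᵥ (λ z → A₁ x z * A₀ z y + + 2 * (A₁ x z * A₁ z y) + A₀ x z * A₁ z y)
  R≡∑ x y = begin
    R x y
      ≡⟨ cong₂ _+_ (cong₂ _+_ (P≡∑ (suc zero) zero x y) (cong (+ 2 *_) (P≡∑ (suc zero) (suc zero) x y)))
                   (P≡∑ zero (suc zero) x y) ⟩
    ∑ᵥ f + + 2 * ∑ᵥ g + ∑ᵥ h
      ≡⟨ cong (λ s → ∑ᵥ f + s + ∑ᵥ h) (∑ᵥ-*ˡ (+ 2) g) ⟩
    ∑ᵥ f + ∑ᵥ (λ z → + 2 * g z) + ∑ᵥ h
      ≡⟨ cong (_+ ∑ᵥ h) (∑ᵥ-distrib-+ f (λ z → + 2 * g z)) ⟨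
    ∑ᵥ (λ z → f z + + 2 * g z) + ∑ᵥ h
      ≡⟨ ∑ᵥ-distrib-+ (λ z → f z + + 2 * g z) h ⟨
    ∑ᵥ (λ z → f z + + 2 * g z + h z) ∎
    where
    open ≡-Reasoning
    f g h : V → ℤ
    f z = A₁ x z * A₀ z y
    g z = A₁ x z * A₁ z y
    h z = A₀ x z * A₁ z y

  SK+KS : ∀ x y → ∑ᵥ (λ z → S x z * K z y + S z y * K z x) ≡ R x y - R y x
  SK+KS x y = begin
    ∑ᵥ (λ z → S x z * K z y + S z y * K z x)   ≡⟨ ∑ᵥ-cong summand ⟩
    ∑ᵥ (λ z → ρ x y z - ρ y x z)               ≡⟨ ∑ᵥ-distrib-− (ρ x y) (ρ y x) ⟩
    ∑ᵥ (ρ x y) - ∑ᵥ (ρ y x)                    ≡⟨ cong₂ _-_ (R≡∑ x y) (R≡∑ y x) ⟨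
    R x y - R y x                              ∎
    where
    open ≡-Reasoning
    ρ : V → V → V → ℤ
    ρ x y z = A₁ x z * A₀ z y + + 2 * (A₁ x z * A₁ z y) + A₀ x z * A₁ z y
    summand : ∀ z → S x z * K z y + S z y * K z x ≡ ρ x y z - ρ y x z
    summand z = begin
      S x z * K z y + S z y * K z x
        ≡⟨ cong₂ _+_ (cong₂ _*_ (S≡A₁-A₁ᵀ x z) (K≡A₀+A₁+A₁ᵀ z y))
                     (cong₂ _*_ (S≡A₁-A₁ᵀ z y) (K≡A₀+A₁+A₁ᵀ z x)) ⟩
      (A₁ x z - A₁ z x) * (A₀ z y + A₁ z y + A₁ y z) + (A₁ z y - A₁ y z) * (A₀ z x + A₁ z x + A₁ x z)
        ≡⟨ commutator-summand (A₁ x z) (A₁ z x) (A₁ y z) (A₁ z y) (A₀ z x) (A₀ z y) ⟩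
      (A₁ x z * A₀ z y + + 2 * (A₁ x z * A₁ z y) + A₀ z x * A₁ z y)
        - (A₁ y z * A₀ z x + + 2 * (A₁ y z * A₁ z x) + A₀ z y * A₁ z x)
        ≡⟨ cong₂ (λ u v → (A₁ x z * A₀ z y + + 2 * (A₁ x z * A₁ z y) + u * A₁ z y)
                           - (A₁ y z * A₀ z x + + 2 * (A₁ y z * A₁ z x) + v * A₁ z x))
                 (A₀-sym z x) (A₀-sym z y) ⟩
      ρ x y z - ρ y x z ∎

  R-apart : ∀ {x y} → Apart x y → R x y - R y x ≡ - (+ 2 * κ) * S x y
  R-apart {x} {y} x≁y = begin
    R x y - R y x
      ≡⟨ cong₂ _-_ (cong₂ _+_ (cong₂ _+_ (P-apart (suc zero) zero {x} {y} x≁y)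
                                          (cong (+ 2 *_) (P-apart (suc zero) (suc zero) {x} {y} x≁y)))
                              (P-apart zero (suc zero) {x} {y} x≁y))
                   (cong₂ _+_ (cong₂ _+_ (P-apart (suc zero) zero {y} {x} y≁x)
                                          (cong (+ 2 *_) (P-apart (suc zero) (suc zero) {y} {x} y≁x)))
                              (P-apart zero (suc zero) {y} {x} y≁x)) ⟩
    E (A₀ y x)                        ≡⟨ cong E (A₀-sym y x) ⟩
    E (A₀ x y)                        ≡⟨ commutator-apart α₁ α₂ β₁ β₂ γ₁ γ₂ u v w ⟩
    - (+ 2 * κ) * (A₁ x y - A₁ y x)   ≡⟨ cong (- (+ 2 * κ) *_) (S≡A₁-A₁ᵀ x y) ⟨
    - (+ 2 * κ) * S x y               ∎
    where
    open ≡-Reasoning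
    y≁x : Apart y x
    y≁x = x≁y ∘ sym
    α₁ = α (suc zero)
    α₂ = α (suc (suc zero))
    β₁ = β (suc zero)
    β₂ = β (suc (suc zero))
    γ₁ = γ (suc zero)
    γ₂ = γ (suc (suc zero))
    u = A₁ x y
    v = A₁ y x
    w = A₀ x y
    E : ℤ → ℤ
    E w′ = (α₁ * u + β₁ * v + γ₁ * w + + 2 * (α₂ * u + β₂ * v + γ₂ * w) + (α₁ * u + β₁ * v + γ₁ * w))
         - (α₁ * v + β₁ * u + γ₁ * w′ + + 2 * (α₂ * v + β₂ * u + γ₂ * w′) + (α₁ * v + β₁ * u + γ₁ * w′))

  block-margins : ∀ {i j} → i ≢ j → ∀ a b →
    row (block i j) a + column (block i j) b ≡ + 2 * κ * block i j a b
  block-margins {i} {j} i≢j a b = begin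
    row (block i j) a + column (block i j) b     ≡⟨ cong₂ _+_ row≡ column≡ ⟩
    - Σ₁ + - Σ₂                                  ≡⟨ ℤ.neg-distrib-+ Σ₁ Σ₂ ⟨
    - (Σ₁ + Σ₂)                                  ≡⟨ cong -_ (∑ᵥ-distrib-+ (λ z → S x z * K z y) (λ z → S z y * K z x)) ⟨
    - ∑ᵥ (λ z → S x z * K z y + S z y * K z x)   ≡⟨ cong -_ (SK+KS x y) ⟩
    - (R x y - R y x)                            ≡⟨ cong -_ (R-apart {x} {y} i≢j) ⟩
    - (- (+ 2 * κ) * S x y)                      ≡⟨ cong -_ (ℤ.neg-distribˡ-* (+ 2 * κ) (S x y)) ⟨
    - - (+ 2 * κ * S x y)                        ≡⟨ ℤ.neg-involutive (+ 2 * κ * S x y) ⟩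
    + 2 * κ * S x y                              ∎
    where
    open ≡-Reasoning
    x y : V
    x = (i , a)
    y = (j , b)
    Σ₁ = ∑ᵥ (λ z → S x z * K z y)
    Σ₂ = ∑ᵥ (λ z → S z y * K z x)
    row≡ : row (block i j) a ≡ - Σ₁
    row≡ = inverseʳ-unique Σ₁ _
      (trans (ℤ.+-comm Σ₁ (row (block i j) a)) (trans (sym (∑ᵥ-split (S x) y)) (S-row-sum x)))
    column≡ : column (block i j) b ≡ - Σ₂
    column≡ = inverseʳ-unique Σ₂ _
      (trans (ℤ.+-comm Σ₂ (column (block i j) b)) (trans (sym (∑ᵥ-split (λ z → S z y) x)) (S-column-sum y)))

  A₀A₁≡A₁A₀ : ∀ x y → P zero (suc zero) x y ≡ P (suc zero) zero x y
  A₀A₁≡A₁A₀ x y = trans (dr zero (suc zero) x y) (sym (dr (suc zero) zero x y))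

  A₀A₀-sym : ∀ x y → P zero zero x y ≡ P zero zero y x
  A₀A₀-sym x y = begin
    P zero zero x y               ≡⟨ P≡∑ zero zero x y ⟩
    ∑ᵥ (λ z → A₀ x z * A₀ z y)    ≡⟨ ∑ᵥ-cong (λ z → trans (ℤ.*-comm (A₀ x z) (A₀ z y))
                                                        (cong₂ _*_ (A₀-sym z y) (A₀-sym x z))) ⟩
    ∑ᵥ (λ z → A₀ y z * A₀ z x)    ≡⟨ P≡∑ zero zero y x ⟨
    P zero zero y x               ∎
    where open ≡-Reasoning

  symmetric-degree : ∀ x y →
    t ≡ + symTo Γ x (proj₁ y) + (P zero zero x y + P zero (suc zero) x y + P (suc zero) zero y x)
  symmetric-degree x y = begin
    t                                      ≡⟨ P₀₀-diagonal x ⟨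
    P zero zero x x                        ≡⟨ P≡∑ zero zero x x ⟩
    ∑ᵥ (λ z → A₀ x z * A₀ z x)             ≡⟨ ∑ᵥ-cong (λ z → trans (cong (A₀ x z *_) (A₀-sym z x))
                                                                  (b2n-idem (symArc Γ x z))) ⟩
    ∑ᵥ (A₀ x)                              ≡⟨ ∑ᵥ-split (A₀ x) y ⟩
    ∑[ b < suc n ] A₀ x (proj₁ y , b) + ∑ᵥ (λ z → A₀ x z * K z y)
                                           ≡⟨ cong₂ _+_ (pos-∑ (suc n) (λ b → b2n (symArc Γ x (proj₁ y , b))))
                                                        (∑ᵥ-cong expand) ⟨
    s + ∑ᵥ (λ z → f z + g z + h z)         ≡⟨ cong (_+_ s) (trans (∑ᵥ-distrib-+ (λ z → f z + g z) h)
                                                                 (cong (_+ ∑ᵥ h) (∑ᵥ-distrib-+ f g))) ⟩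
    s + (∑ᵥ f + ∑ᵥ g + ∑ᵥ h)               ≡⟨ cong (_+_ s) (cong₂ _+_ (cong₂ _+_ (P≡∑ zero zero x y)
                                                                              (P≡∑ zero (suc zero) x y))
                                                                 (P≡∑ (suc zero) zero y x)) ⟨
    s + (P zero zero x y + P zero (suc zero) x y + P (suc zero) zero y x) ∎
    where
    open ≡-Reasoning
    s : ℤ
    s = + symTo Γ x (proj₁ y)
    f g h : V → ℤ
    f z = A₀ x z * A₀ z y
    g z = A₀ x z * A₁ z y
    h z = A₁ y z * A₀ z x
    expand : ∀ z → f z + g z + h z ≡ A₀ x z * K z y
    expand z = begin
      f z + g z + h z                                       ≡⟨ cong (λ c → f z + g z + A₁ y z * c) (A₀-sym z x) ⟩
      A₀ x z * A₀ z y + A₀ x z * A₁ z y + A₁ y z * A₀ x z   ≡⟨ distrib (A₀ x z) (A₀ z y) (A₁ z y) (A₁ y z) ⟩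
      A₀ x z * (A₀ z y + A₁ z y + A₁ y z)                   ≡⟨ cong (A₀ x z *_) (K≡A₀+A₁+A₁ᵀ z y) ⟨
      A₀ x z * K z y                                        ∎
      where
      distrib : ∀ s a b c → s * a + s * b + c * s ≡ s * (a + b + c)
      distrib = solve-∀

  symTo-sym : ∀ x y → symTo Γ x (proj₁ y) ≡ symTo Γ y (proj₁ x)
  symTo-sym x y = ℤ.+-injective (∙-cancelʳ (Q x y) _ _ (begin
    + symTo Γ x (proj₁ y) + Q x y    ≡⟨ symmetric-degree x y ⟨
    t                                ≡⟨ symmetric-degree y x ⟩
    + symTo Γ y (proj₁ x) + Q y x    ≡⟨ cong (_+_ (+ symTo Γ y (proj₁ x))) Q-sym ⟩
    + symTo Γ y (proj₁ x) + Q x y    ∎))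
    where
    open ≡-Reasoning
    Q : V → V → ℤ
    Q x y = P zero zero x y + P zero (suc zero) x y + P (suc zero) zero y x
    Q-sym : Q y x ≡ Q x y
    Q-sym = begin
      P zero zero y x + P zero (suc zero) y x + P (suc zero) zero x y
        ≡⟨ cong₂ _+_ (cong₂ _+_ (A₀A₀-sym y x) (A₀A₁≡A₁A₀ y x)) (sym (A₀A₁≡A₁A₀ x y)) ⟩
      P zero zero x y + P (suc zero) zero y x + P zero (suc zero) x y
        ≡⟨ swap (P zero zero x y) (P (suc zero) zero y x) (P zero (suc zero) x y) ⟩
      P zero zero x y + P zero (suc zero) x y + P (suc zero) zero y x ∎
      where
      swap : ∀ a b c → a + b + c ≡ a + c + b
      swap = solve-∀

  typeII : κ ≡ 0ℤ → TypeII Γ p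
  typeII κ≡0 = κ≡0 , c , e , λ i j i≢j →
    (λ a → halve (trans (twice-out+sym i≢j a) (sym (twice-out+sym i≢j zero))) (sym-constant a)) ,
    sym-constant ,
    halve (trans (twice-out+sym i≢j zero) (sym (twice-out+sym (i≢j ∘ sym) zero)))
          (symTo-sym (i , zero) (j , zero)) ,
    twice-out+sym i≢j zero
    where
    c e : Fin m → Fin m → ℕ
    c i j = outTo Γ (i , zero) j
    e i j = symTo Γ (i , zero) j
    sym-constant : ∀ {i j} a → symTo Γ (i , a) j ≡ e i j
    sym-constant {i} {j} a = trans (symTo-sym (i , a) (j , a)) (symTo-sym (j , a) (i , zero))
    halve : ∀ {x y s s′} → 2 ℕ.* x ℕ.+ s ≡ 2 ℕ.* y ℕ.+ s′ → s ≡ s′ → x ≡ y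
    halve {x} {y} {s} eq refl = ℕ.*-cancelˡ-≡ x y 2 (ℕ.+-cancelʳ-≡ s (2 ℕ.* x) (2 ℕ.* y) eq)
    out≡in : ∀ {i j} → i ≢ j → ∀ a → outTo Γ (i , a) j ≡ inFrom (i , a) j
    out≡in {i} {j} i≢j a = ℤ.+-injective (ℤ.i-j≡0⇒i≡j _ _ (trans (sym (row-flow (i , a) j))
      (Margins.rows-vanish (block i j) (+ 2 * κ) (block-margins i≢j) (cong (+ 2 *_) κ≡0) a)))
    twice-out+sym : ∀ {i j} → i ≢ j → ∀ a → 2 ℕ.* outTo Γ (i , a) j ℕ.+ symTo Γ (i , a) j ≡ suc n
    twice-out+sym {i} {j} i≢j a = begin
      2 ℕ.* outTo Γ x j ℕ.+ symTo Γ x j            ≡⟨ rearrange (outTo Γ x j) (symTo Γ x j) ⟩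
      symTo Γ x j ℕ.+ outTo Γ x j ℕ.+ outTo Γ x j  ≡⟨ cong (symTo Γ x j ℕ.+ outTo Γ x j ℕ.+_) (out≡in i≢j a) ⟩
      symTo Γ x j ℕ.+ outTo Γ x j ℕ.+ inFrom x j   ≡⟨ team-sum i≢j a ⟩
      suc n                                        ∎
      where
      open ≡-Reasoning
      x = (i , a)
      rearrange : ∀ o s → 2 ℕ.* o ℕ.+ s ≡ s ℕ.+ o ℕ.+ o
      rearrange = ℕ-Solver.solve-∀

  zeros-balanced : ∀ {i j} → i ≢ j → ∀ a b →
    count (λ b′ → block i j a b′ ℤ.≟ 0ℤ) ≡ count (λ a′ → block i j a′ b ℤ.≟ 0ℤ)
  zeros-balanced {i} {j} i≢j a b = begin
    count (λ b′ → block i j a b′ ℤ.≟ 0ℤ)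
      ≡⟨ ∑-cong (suc n) (λ b′ → cong b2n (symArc≡S≟0 {i , a} {j , b′} i≢j)) ⟨
    symTo Γ (i , a) j
      ≡⟨ symTo-sym (i , a) (j , b) ⟩
    symTo Γ (j , b) i
      ≡⟨ ∑-cong (suc n) (λ a′ → cong b2n (∧-comm (arc Γ (j , b) (i , a′)) (arc Γ (i , a′) (j , b)))) ⟩
    ∑ (suc n) (λ a′ → b2n (symArc Γ (i , a′) (j , b)))
      ≡⟨ ∑-cong (suc n) (λ a′ → cong b2n (symArc≡S≟0 {i , a′} {j , b} i≢j)) ⟩
    count (λ a′ → block i j a′ b ℤ.≟ 0ℤ) ∎
    where open ≡-Reasoning

  typeIII : + 2 * κ ≡ + suc n → TypeIII Γ p
  typeIII 2κ≡r = 2κ≡r , λ i j i≢j → block-cases i≢j (Classification.classify (block i j)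
    (λ a b → trans (block-margins i≢j a b) (cong (_* block i j a b) 2κ≡r))
    (λ a b → S-trit (i , a) (j , b)) (zeros-balanced i≢j))

  typeI : κ ≡ + suc n → TypeI Γ p
  typeI κ≡r = κ≡r , m , Σ′ , semicomplete , ↔-id V , λ { (i , a) (j , b) → lexicographic i j a b }
    where
    Σ′ : Digraph (Fin m)
    Σ′ = mkDigraph (λ i j → arc Γ (i , zero) (j , zero))
    semicomplete : Semicomplete Σ′
    semicomplete = (λ i → within i zero zero) , (λ i j → across i j zero zero)
    k≡2r : + 2 * κ ≡ + 2 * + suc n
    k≡2r = cong (+ 2 *_) κ≡r
    2r≢0 : + 2 * + suc n ≢ 0ℤ
    2r≢0 ()
    block-constant : ∀ {i j} → i ≢ j → ∀ a b → block i j a b ≡ block i j zero zero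
    block-constant i≢j a b = constant (block-margins i≢j)
      (2r≢0 ∘ trans (sym k≡2r)) (2r≢r n ∘ trans (sym k≡2r)) a b zero zero
    lexicographic : ∀ i j a b →
      arc Γ (i , a) (j , b) ≡ (arc Γ (i , zero) (j , zero) ∨ (⌊ i ≟ j ⌋ ∧ false))
    lexicographic i j a b with i ≟ j
    ... | yes refl = trans (within i a b) (sym (cong (_∨ false) (within i zero zero)))
    ... | no i≢j = begin
      arc Γ (i , a) (j , b)                      ≡⟨ arc≡S≢-1 {i , a} {j , b} i≢j ⟩
      not (does (block i j a b ℤ.≟ -1ℤ))         ≡⟨ cong (λ s → not (does (s ℤ.≟ -1ℤ))) (block-constant i≢j a b) ⟩
      not (does (block i j zero zero ℤ.≟ -1ℤ))   ≡⟨ arc≡S≢-1 {i , zero} {j , zero} i≢j ⟨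
      arc Γ (i , zero) (j , zero)                ≡⟨ ∨-identityʳ _ ⟨
      arc Γ (i , zero) (j , zero) ∨ false        ∎
      where open ≡-Reasoning

  one-way-free : κ ≢ 0ℤ → + 2 * κ ≢ + suc n → κ ≢ + suc n → ∀ x y → oneArc Γ x y ≡ false
  one-way-free κ≢0 2κ≢r κ≢r (i , a) (j , b) with i ≟ j
  ... | yes refl = cong (_∧ not (arc Γ (i , b) (i , a))) (within i a b)
  ... | no i≢j = S≡0⇒¬oneArc {i , a} {j , b}
    (Margins.constant-vanishes (block i j) (+ 2 * κ) (block-margins i≢j)
      (κ≢r ∘ ℤ.*-cancelˡ-≡ (+ 2) κ (+ suc n))
      (constant (block-margins i≢j) (κ≢0 ∘ *-cancel-zero {+ 2} (λ ())) 2κ≢r) a b)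

theorem3p9 : (m r : ℕ) (Γ : Digraph (Vtx m r)) →
    IsTeamSMD m r Γ → DoublyRegular Γ →
    Σ (DRParams Γ) λ p → SatisfiesDR Γ p × (TypeI Γ p ⊎ TypeII Γ p ⊎ TypeIII Γ p)
theorem3p9 m zero          Γ (_ , () , _) _
theorem3p9 m (suc zero)    Γ (_ , s≤s () , _) _
theorem3p9 m (suc (suc n)) Γ (_ , _ , within , across) ((_ , regular) , (p , dr)) = types
  where
  open DoublyRegularTeam Γ within across regular using (typeI; typeII; typeIII; one-way-free)
  types : Σ (DRParams Γ) λ q → SatisfiesDR Γ q × (TypeI Γ q ⊎ TypeII Γ q ⊎ TypeIII Γ q)
  types with keyValue Γ p ℤ.≟ 0ℤ | + 2 * keyValue Γ p ℤ.≟ + suc (suc n) | keyValue Γ p ℤ.≟ + suc (suc n)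
  ... | yes κ≡0 | _        | _       = p , dr , inj₂ (inj₁ (typeII p dr κ≡0))
  ... | no _    | yes 2κ≡r | _       = p , dr , inj₂ (inj₂ (typeIII p dr 2κ≡r))
  ... | no _    | no _     | yes κ≡r = p , dr , inj₁ (typeI p dr κ≡r)
  ... | no κ≢0  | no 2κ≢r  | no κ≢r  = p₀ , dr₀ , inj₂ (inj₁ (typeII p₀ dr₀ refl))
    where
    -- Γ has no one-way arcs, so α and β are unconstrained; taking them 0 makes κ = 0.
    p₀ : DRParams Γ
    p₀ = record p { α = λ _ → 0ℤ ; β = λ _ → 0ℤ }
    dr₀ : SatisfiesDR Γ p₀
    dr₀ = without-one-way-arcs {p = p} (one-way-free p dr κ≢0 2κ≢r κ≢r) dr
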